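{- Let $n \geq 1$ be an integer and let $F_m$ denote the $m$th Fibonacci number ($F_0=0$, $F_1=1$). Consider the following subsets of $\mathbb{Z}/F_{2n}\mathbb{Z}$: \[ \mathcal{A}_1 = \{0\} \cup \{F_{2k-1} \mid 1 \leq k \leq n\}, \quad \mathcal{A}_2 = \{F_k F_{2n-k} \mid 0 \leq k \leq n\}, \quad \mathcal{B} = \{(-1)^{k+1} F_k^2 \mid 0 \leq k \leq n\}. \] Then $(n-1)\mathcal{A}_1 = (n-1)\mathcal{A}_2 = (n-1)\mathcal{B} = \mathbb{Z}/F_{2n}\mathbb{Z}$, i.e., every integer modulo $F_{2n}$ is a sum of $n-1$ elements of each of these sets. Moreover, if $n \geq 2$, then $(n-2)\mathcal{A}_1$, $(n-2)\mathcal{A}_2$ and $(n-2)\mathcal{B}$ are each proper subsets of $\mathbb{Z}/F_{2n}\mathbb{Z}$.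
   Context: For a subset $\mathcal{A}$ of an abelian group and an integer $m \geq 1$, $m\mathcal{A} = \{a_1 + \cdots + a_m \mid a_i \in \mathcal{A}\}$, and $0\mathcal{A} = \{0\}$. -}

module Defs where

open import Data.Nat as ℕ using (ℕ; zero; suc)
open import Data.Integer using (ℤ; +_; _-_; _*_; -_)
open import Data.Integer.Divisibility using (_∣_)
open import Data.Vec using (Vec)
open import Data.Vec.Relation.Unary.All using (All)
open import Data.List using (List; []; _∷_; map; upTo)
open import Data.List.Membership.Propositional using (_∈_)
open import Data.Product using (Σ; _×_)
import Data.Vec as V

fib : ℕ → ℕ
fib zero = zero
fib (suc zero) = suc zero
fib (suc (suc n)) = fib (suc n) ℕ.+ fib n

F : ℕ → ℤ
F k = + fib k

_≡_[mod_] : ℤ → ℤ → ℤ → Set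
x ≡ y [mod N ] = N ∣ (x - y)

sumℤ : ∀ {m} → Vec ℤ m → ℤ
sumℤ = V.foldr _ Data.Integer._+_ (+ 0)

-- A subset of ℤ/Nℤ is given by a list of integer representatives.
-- x (mod N) lies in the m-fold sumset mA: x ≡ a₁ + ⋯ + aₘ (mod N) with aᵢ ∈ A.
-- For m = 0 the empty sum is 0, matching 0A = {0}.
InSumset : (N : ℤ) (m : ℕ) (A : List ℤ) (x : ℤ) → Set
InSumset N m A x = Σ (Vec ℤ m) λ as → All (_∈ A) as × (x ≡ sumℤ as [mod N ])

SumsetFull : (N : ℤ) (m : ℕ) (A : List ℤ) → Set
SumsetFull N m A = (x : ℤ) → InSumset N m A x

SumsetProper : (N : ℤ) (m : ℕ) (A : List ℤ) → Set
SumsetProper N m A = Σ ℤ λ x → InSumset N m A x → Data.Empty.⊥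
  where import Data.Empty

sign : ℕ → ℤ
sign zero = + 1
sign (suc k) = - sign k

modulus : ℕ → ℤ
modulus n = F (2 ℕ.* n)

-- A₁ = {0} ∪ {F_{2k-1} | 1 ≤ k ≤ n}; k = j+1 with j < n, so 2k-1 = 2j+1
A₁ : ℕ → List ℤ
A₁ n = + 0 ∷ map (λ j → F (suc (2 ℕ.* j))) (upTo n)

A₂ : ℕ → List ℤ
A₂ n = map (λ k → F k * F (2 ℕ.* n ℕ.∸ k)) (upTo (suc n))

B : ℕ → List ℤ
B n = map (λ k → sign (suc k) * (F k * F k)) (upTo (suc n))

-- By induction on n, the (n − 1)-fold sums cover F₂ₙ consecutive integers: the new
-- summands 0, F₂ₙ₋₁, F₂ₙ₊₁ of A₁ (and 0, ±F²ₙ₋₁, ∓F²ₙ, ±F²ₙ₊₁ of B) have consecutive gaps at most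
-- F₂ₙ, so translating the interval by them covers F₂ₙ₊₂ consecutive integers.
--
-- A₁ and B are the values on the vertices 0, …, n of weights φ on the fan (vertex
-- j ≥ 2 joined to j − 1 and 0) and on the triangle strip (j joined to j − 1 and j − 2).  Both
-- graphs have genus n − 1, and a divisor D of degree zero is principal as soon as F₂ₙ divides
-- Σ D(v)φ(v).  The divisor ν of the orientation towards larger vertices has degree n − 2 and
-- is not equivalent to an effective divisor, so Σ ν(v)φ(v) is not a sum of n − 2 elements.
--
-- A₂.  Catalan's identity gives A₂ = F²ₙ + (−1)ⁿ B elementwise, and this affine bijection of
-- ℤ/F₂ₙℤ transfers both statements from B to A₂.

{-# OPTIONS --safe #-}
module Submission where

open import Defs
open import Data.Nat as ℕ using (ℕ; zero; suc; _≥_; _∸_; z≤n; s≤s; _≤′_; ≤′-refl; ≤′-step)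
import Data.Nat.Properties as ℕₚ
import Data.Nat.Tactic.RingSolver as ℕ-Solver
open import Data.Integer as ℤ using (ℤ; +_; _+_; _-_; _*_; -_; _≤_; _<_; 0ℤ; 1ℤ; -1ℤ)
import Data.Integer.Properties as ℤₚ
open import Data.Integer.DivMod using (_%ℕ_; _/ℕ_; a≡a%ℕn+[a/ℕn]*n; n%ℕd<d)
open import Data.Integer.Divisibility.Signed using (_∣_; divides; ∣m⇒∣-m; ∣-trans; ∣n⇒∣m*n; ∣ᵤ⇒∣; ∣⇒∣ᵤ)
open import Data.Integer.Tactic.RingSolver using (solve-∀)
open import Data.List using (List; []; _∷_; _++_; map; upTo)
open import Data.List.Relation.Unary.All as All using (All; []; _∷_)
open import Data.List.Relation.Unary.All.Properties using (++⁺)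
open import Data.List.Relation.Unary.Any using (here; there)
open import Data.List.Membership.Propositional using (_∈_)
open import Data.List.Membership.Propositional.Properties using (∈-map⁺; ∈-map⁻; ∈-upTo⁺; ∈-upTo⁻)
open import Data.Vec as V using (Vec; []; _∷_)
open import Data.Vec.Relation.Unary.All as VAll using ([]; _∷_)
open import Data.Vec.Relation.Unary.All.Properties using (map⁺)
open import Data.Product as Product using (Σ; _×_; _,_; proj₁; proj₂)
open import Data.Sum using (_⊎_; inj₁; inj₂)
open import Data.Empty using (⊥-elim)
open import Function using (_∘_)
open import Relation.Nullary using (¬_; yes; no)
open import Relation.Binary.PropositionalEquality
  using (_≡_; _≢_; refl; sym; trans; cong; cong₂; subst; module ≡-Reasoning)

∑≤ : ℕ → (ℕ → ℤ) → ℤ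
∑≤ zero    g = g 0
∑≤ (suc m) g = ∑≤ m g + g (suc m)

syntax ∑≤ m (λ v → e) = ∑[ v ≤ m ] e

∑-cong : ∀ m {g h : ℕ → ℤ} → (∀ v → v ℕ.≤ m → g v ≡ h v) → ∑≤ m g ≡ ∑≤ m h
∑-cong zero    g≡h = g≡h 0 z≤n
∑-cong (suc m) g≡h =
  cong₂ _+_ (∑-cong m λ v v≤m → g≡h v (ℕₚ.m≤n⇒m≤1+n v≤m)) (g≡h (suc m) ℕₚ.≤-refl)

∑-zero : ∀ m {g : ℕ → ℤ} → (∀ v → v ℕ.≤ m → g v ≡ 0ℤ) → ∑≤ m g ≡ 0ℤ
∑-zero zero    g≡0 = g≡0 0 z≤n
∑-zero (suc m) g≡0 =
  cong₂ _+_ (∑-zero m λ v v≤m → g≡0 v (ℕₚ.m≤n⇒m≤1+n v≤m)) (g≡0 (suc m) ℕₚ.≤-refl)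

∑-+ : ∀ m (g h : ℕ → ℤ) → ∑[ v ≤ m ] (g v + h v) ≡ ∑≤ m g + ∑≤ m h
∑-+ zero    g h = refl
∑-+ (suc m) g h = trans (cong (_+ (g (suc m) + h (suc m))) (∑-+ m g h))
  (interchange (∑≤ m g) (∑≤ m h) (g (suc m)) (h (suc m)))
  where
  interchange : ∀ a b c d → a + b + (c + d) ≡ a + c + (b + d)
  interchange = solve-∀

∑-* : ∀ m c (g : ℕ → ℤ) → ∑[ v ≤ m ] (c * g v) ≡ c * ∑≤ m g
∑-* zero    c g = refl
∑-* (suc m) c g = trans (cong (_+ c * g (suc m)) (∑-* m c g))
  (sym (ℤₚ.*-distribˡ-+ c (∑≤ m g) (g (suc m))))

δ : ℕ → ℕ → ℤ
δ zero    zero    = 1ℤ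
δ zero    (suc _) = 0ℤ
δ (suc _) zero    = 0ℤ
δ (suc a) (suc v) = δ a v

δ-refl : ∀ a → δ a a ≡ 1ℤ
δ-refl zero    = refl
δ-refl (suc a) = δ-refl a

δ-≢ : ∀ {a v} → a ≢ v → δ a v ≡ 0ℤ
δ-≢ {zero}  {zero}  a≢v = ⊥-elim (a≢v refl)
δ-≢ {zero}  {suc v} a≢v = refl
δ-≢ {suc a} {zero}  a≢v = refl
δ-≢ {suc a} {suc v} a≢v = δ-≢ λ a≡v → a≢v (cong suc a≡v)

0≤δ : ∀ a v → 0ℤ ≤ δ a v
0≤δ zero    zero    = ℤ.+≤+ z≤n
0≤δ zero    (suc v) = ℤ.+≤+ z≤n
0≤δ (suc a) zero    = ℤ.+≤+ z≤n
0≤δ (suc a) (suc v) = 0≤δ a v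

∑-δ : ∀ m {a} (h : ℕ → ℤ) → a ℕ.≤ m → ∑[ v ≤ m ] (δ a v * h v) ≡ h a
∑-δ zero    {zero}  h z≤n = ℤₚ.*-identityˡ (h 0)
∑-δ (suc m) {a}     h a≤1+m with a ℕ.≟ suc m
... | yes refl = begin
  ∑[ v ≤ m ] (δ (suc m) v * h v) + δ (suc m) (suc m) * h (suc m)
    ≡⟨ cong₂ _+_ (∑-zero m λ v v≤m → cong (_* h v) (δ-≢ (ℕₚ.>⇒≢ (s≤s v≤m))))
                 (trans (cong (_* h (suc m)) (δ-refl m)) (ℤₚ.*-identityˡ (h (suc m)))) ⟩
  0ℤ + h (suc m)
    ≡⟨ ℤₚ.+-identityˡ (h (suc m)) ⟩
  h (suc m) ∎
  where open ≡-Reasoning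
... | no a≢1+m = begin
  ∑[ v ≤ m ] (δ a v * h v) + δ a (suc m) * h (suc m)
    ≡⟨ cong₂ _+_ (∑-δ m h (ℕₚ.≤-pred (ℕₚ.≤∧≢⇒< a≤1+m a≢1+m))) (cong (_* h (suc m)) (δ-≢ a≢1+m)) ⟩
  h a + 0ℤ
    ≡⟨ ℤₚ.+-identityʳ (h a) ⟩
  h a ∎
  where open ≡-Reasoning

∑-low : ∀ m (g : ℕ → ℤ) → 1 ℕ.≤ m → (∀ v → 1 ℕ.< v → v ℕ.≤ m → g v ≡ 0ℤ) → ∑≤ m g ≡ g 0 + g 1
∑-low (suc zero)    g _ _       = refl
∑-low (suc (suc m)) g _ g≡0 = begin
  ∑≤ (suc m) g + g (suc (suc m))
    ≡⟨ cong₂ _+_ (∑-low (suc m) g (s≤s z≤n) λ v 1<v v≤1+m → g≡0 v 1<v (ℕₚ.m≤n⇒m≤1+n v≤1+m))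
                 (g≡0 (suc (suc m)) (s≤s (s≤s z≤n)) ℕₚ.≤-refl) ⟩
  g 0 + g 1 + 0ℤ
    ≡⟨ ℤₚ.+-identityʳ _ ⟩
  g 0 + g 1 ∎
  where open ≡-Reasoning

∑-lincomb : ∀ m (D G g : ℕ → ℤ) c →
            ∑[ v ≤ m ] ((D v + c * G v) * g v) ≡ ∑[ v ≤ m ] (D v * g v) + c * ∑[ v ≤ m ] (G v * g v)
∑-lincomb m D G g c = begin
  ∑[ v ≤ m ] ((D v + c * G v) * g v)                 ≡⟨ ∑-cong m (λ v _ → distribute (D v) c (G v) (g v)) ⟩
  ∑[ v ≤ m ] (D v * g v + c * (G v * g v))           ≡⟨ ∑-+ m (λ v → D v * g v) (λ v → c * (G v * g v)) ⟩
  ∑[ v ≤ m ] (D v * g v) + ∑[ v ≤ m ] (c * (G v * g v))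
    ≡⟨ cong (λ x → ∑[ v ≤ m ] (D v * g v) + x) (∑-* m c (λ v → G v * g v)) ⟩
  ∑[ v ≤ m ] (D v * g v) + c * ∑[ v ≤ m ] (G v * g v) ∎
  where
  open ≡-Reasoning
  distribute : ∀ d c x y → (d + c * x) * y ≡ d * y + c * (x * y)
  distribute = solve-∀

∑-sub : ∀ m (D G g : ℕ → ℤ) → ∑[ v ≤ m ] ((D v - G v) * g v) ≡ ∑[ v ≤ m ] (D v * g v) - ∑[ v ≤ m ] (G v * g v)
∑-sub m D G g = begin
  ∑[ v ≤ m ] ((D v - G v) * g v)                        ≡⟨ ∑-cong m (λ v _ → cong (_* g v) (as-lincomb (D v) (G v))) ⟩
  ∑[ v ≤ m ] ((D v + -1ℤ * G v) * g v)                  ≡⟨ ∑-lincomb m D G g -1ℤ ⟩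
  ∑[ v ≤ m ] (D v * g v) + -1ℤ * ∑[ v ≤ m ] (G v * g v)
    ≡⟨ as-lincomb (∑[ v ≤ m ] (D v * g v)) (∑[ v ≤ m ] (G v * g v)) ⟨
  ∑[ v ≤ m ] (D v * g v) - ∑[ v ≤ m ] (G v * g v)        ∎
  where
  open ≡-Reasoning
  as-lincomb : ∀ x y → x - y ≡ x + -1ℤ * y
  as-lincomb = solve-∀

count : ∀ {n} → Vec ℕ n → ℕ → ℤ
count []       v = 0ℤ
count (x ∷ xs) v = δ x v + count xs v

0≤count : ∀ {n} (xs : Vec ℕ n) v → 0ℤ ≤ count xs v
0≤count []       v = ℤₚ.≤-refl
0≤count (x ∷ xs) v = ℤₚ.+-mono-≤ (0≤δ x v) (0≤count xs v)

∑-count : ∀ m {n} (xs : Vec ℕ n) (g : ℕ → ℤ) → VAll.All (ℕ._≤ m) xs →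
          ∑[ v ≤ m ] (count xs v * g v) ≡ sumℤ (V.map g xs)
∑-count m []       g []            = ∑-zero m λ _ _ → refl
∑-count m (x ∷ xs) g (x≤m ∷ xs≤m) = begin
  ∑[ v ≤ m ] ((δ x v + count xs v) * g v)
    ≡⟨ ∑-cong m (λ v _ → ℤₚ.*-distribʳ-+ (g v) (δ x v) (count xs v)) ⟩
  ∑[ v ≤ m ] (δ x v * g v + count xs v * g v)
    ≡⟨ ∑-+ m (λ v → δ x v * g v) (λ v → count xs v * g v) ⟩
  ∑[ v ≤ m ] (δ x v * g v) + ∑[ v ≤ m ] (count xs v * g v)
    ≡⟨ cong₂ _+_ (∑-δ m g x≤m) (∑-count m xs g xs≤m) ⟩
  g x + sumℤ (V.map g xs) ∎
  where open ≡-Reasoning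

sumℤ-ones : ∀ {n} (xs : Vec ℕ n) → sumℤ (V.map (λ _ → 1ℤ) xs) ≡ + n
sumℤ-ones []       = refl
sumℤ-ones (x ∷ xs) = cong (λ s → 1ℤ + s) (sumℤ-ones xs)

-- Laplacians of edge lists

Edge : Set
Edge = ℕ × ℕ

Endpoints : (ℕ → Set) → List Edge → Set
Endpoints P = All λ e → P (proj₁ e) × P (proj₂ e)

endpoints-map : ∀ {P Q : ℕ → Set} {es} → (∀ {u} → P u → Q u) → Endpoints P es → Endpoints Q es
endpoints-map P⇒Q = All.map (Product.map P⇒Q P⇒Q)

edgeΔ : Edge → (ℕ → ℤ) → ℕ → ℤ
edgeΔ (a , b) f v = δ a v * (f a - f b) + δ b v * (f b - f a)

Δ : List Edge → (ℕ → ℤ) → ℕ → ℤ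
Δ []       f v = 0ℤ
Δ (e ∷ es) f v = edgeΔ e f v + Δ es f v

edgeΔ-lower : ∀ {a b} f → a ≢ b → edgeΔ (a , b) f a ≡ f a - f b
edgeΔ-lower {a} {b} f a≢b = begin
  δ a a * (f a - f b) + δ b a * (f b - f a) ≡⟨ cong₂ (λ x y → x * (f a - f b) + y * (f b - f a))
                                                      (δ-refl a) (δ-≢ λ b≡a → a≢b (sym b≡a)) ⟩
  1ℤ * (f a - f b) + 0ℤ * (f b - f a)       ≡⟨ simplify (f a - f b) (f b - f a) ⟩
  f a - f b                                  ∎
  where
  open ≡-Reasoning
  simplify : ∀ x y → 1ℤ * x + 0ℤ * y ≡ x
  simplify = solve-∀

edgeΔ-upper : ∀ {a b} f → a ≢ b → edgeΔ (a , b) f b ≡ f b - f a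
edgeΔ-upper {a} {b} f a≢b = begin
  δ a b * (f a - f b) + δ b b * (f b - f a) ≡⟨ cong₂ (λ x y → x * (f a - f b) + y * (f b - f a))
                                                      (δ-≢ a≢b) (δ-refl b) ⟩
  0ℤ * (f a - f b) + 1ℤ * (f b - f a)       ≡⟨ simplify (f a - f b) (f b - f a) ⟩
  f b - f a                                  ∎
  where
  open ≡-Reasoning
  simplify : ∀ x y → 0ℤ * x + 1ℤ * y ≡ y
  simplify = solve-∀

edgeΔ-away : ∀ {a b v} f → a ≢ v → b ≢ v → edgeΔ (a , b) f v ≡ 0ℤ
edgeΔ-away {a} {b} f a≢v b≢v =
  cong₂ (λ x y → x * (f a - f b) + y * (f b - f a)) (δ-≢ a≢v) (δ-≢ b≢v)

edgeΔ-vanishing : ∀ {a b} f v → f a ≡ 0ℤ → f b ≡ 0ℤ → edgeΔ (a , b) f v ≡ 0ℤ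
edgeΔ-vanishing {a} {b} f v fa≡0 fb≡0 rewrite fa≡0 | fb≡0 = simplify (δ a v) (δ b v)
  where
  simplify : ∀ x y → x * (0ℤ - 0ℤ) + y * (0ℤ - 0ℤ) ≡ 0ℤ
  simplify = solve-∀

Δ-++ : ∀ es fs f v → Δ (es ++ fs) f v ≡ Δ es f v + Δ fs f v
Δ-++ []       fs f v = sym (ℤₚ.+-identityˡ (Δ fs f v))
Δ-++ (e ∷ es) fs f v = trans (cong (λ x → edgeΔ e f v + x) (Δ-++ es fs f v))
  (sym (ℤₚ.+-assoc (edgeΔ e f v) (Δ es f v) (Δ fs f v)))

Δ-linear : ∀ es (f g : ℕ → ℤ) c v → Δ es (λ w → f w + c * g w) v ≡ Δ es f v + c * Δ es g v
Δ-linear []             f g c v = sym (trans (ℤₚ.+-identityˡ (c * 0ℤ)) (ℤₚ.*-zeroʳ c))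
Δ-linear ((a , b) ∷ es) f g c v =
  trans (cong (λ x → edgeΔ (a , b) (λ w → f w + c * g w) v + x) (Δ-linear es f g c v))
  (regroup (δ a v) (δ b v) (f a) (f b) (g a) (g b) c (Δ es f v) (Δ es g v))
  where
  regroup : ∀ da db fa fb ga gb c x y →
    da * (fa + c * ga - (fb + c * gb)) + db * (fb + c * gb - (fa + c * ga)) + (x + c * y)
      ≡ da * (fa - fb) + db * (fb - fa) + x + c * (da * (ga - gb) + db * (gb - ga) + y)
  regroup = solve-∀

Δ-const : ∀ es c v → Δ es (λ _ → c) v ≡ 0ℤ
Δ-const []             c v = refl
Δ-const ((a , b) ∷ es) c v = trans (cong (λ x → edgeΔ (a , b) (λ _ → c) v + x) (Δ-const es c v))
  (simplify (δ a v) (δ b v) c)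
  where
  simplify : ∀ x y c → x * (c - c) + y * (c - c) + 0ℤ ≡ 0ℤ
  simplify = solve-∀

Δ-notIncident : ∀ {es v} f → Endpoints (_≢ v) es → Δ es f v ≡ 0ℤ
Δ-notIncident f []                       = refl
Δ-notIncident f ((a≢v , b≢v) ∷ es≢v) =
  cong₂ _+_ (edgeΔ-away f a≢v b≢v) (Δ-notIncident f es≢v)

Δ-beyond-support : ∀ {es v} g → (∀ w → v ℕ.≤ w → g w ≡ 0ℤ) → All (λ e → v ℕ.< proj₂ e) es → Δ es g v ≡ 0ℤ
Δ-beyond-support g g≡0 [] = refl
Δ-beyond-support {(a , b) ∷ es} {v} g g≡0 (v<b ∷ rest) = cong₂ _+_ edge≡0 (Δ-beyond-support g g≡0 rest)
  where
  edge≡0 : edgeΔ (a , b) g v ≡ 0ℤ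
  edge≡0 with v ℕ.≤? a
  ... | yes v≤a = edgeΔ-vanishing g v (g≡0 a v≤a) (g≡0 b (ℕₚ.<⇒≤ v<b))
  ... | no v≰a  = edgeΔ-away g (ℕₚ.<⇒≢ (ℕₚ.≰⇒> v≰a)) (ℕₚ.>⇒≢ v<b)

Δ-nonpos-at-minimum : ∀ {es} f v → Endpoints (λ u → f v ≤ f u) es → Δ es f v ≤ 0ℤ
Δ-nonpos-at-minimum f v [] = ℤₚ.≤-refl
Δ-nonpos-at-minimum {(a , b) ∷ es} f v ((fv≤fa , fv≤fb) ∷ rest) =
  ℤₚ.+-mono-≤ edge≤0 (Δ-nonpos-at-minimum f v rest)
  where
  edge≤0 : edgeΔ (a , b) f v ≤ 0ℤ
  edge≤0 with a ℕ.≟ v | b ℕ.≟ v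
  ... | yes refl | yes refl = ℤₚ.≤-reflexive (loop (δ a a) (f a))
    where
    loop : ∀ x y → x * (y - y) + x * (y - y) ≡ 0ℤ
    loop = solve-∀
  ... | yes refl | no b≢a = ℤₚ.≤-trans (ℤₚ.≤-reflexive (edgeΔ-lower f λ a≡b → b≢a (sym a≡b)))
                                       (ℤₚ.i≤j⇒i-j≤0 fv≤fb)
  ... | no a≢b | yes refl = ℤₚ.≤-trans (ℤₚ.≤-reflexive (edgeΔ-upper f a≢b)) (ℤₚ.i≤j⇒i-j≤0 fv≤fa)
  ... | no a≢v | no b≢v = ℤₚ.≤-reflexive (edgeΔ-away f a≢v b≢v)

∑-edgeΔ : ∀ m {a b} (f g : ℕ → ℤ) → a ℕ.≤ m → b ℕ.≤ m →
          ∑[ v ≤ m ] (edgeΔ (a , b) f v * g v) ≡ (f a - f b) * (g a - g b)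
∑-edgeΔ m {a} {b} f g a≤m b≤m = begin
  ∑[ v ≤ m ] (edgeΔ (a , b) f v * g v)
    ≡⟨ ∑-cong m (λ v _ → distribute (δ a v) (δ b v) (f a) (f b) (g v)) ⟩
  ∑[ v ≤ m ] (δ a v * ((f a - f b) * g v) + δ b v * ((f b - f a) * g v))
    ≡⟨ ∑-+ m (λ v → δ a v * ((f a - f b) * g v)) (λ v → δ b v * ((f b - f a) * g v)) ⟩
  ∑[ v ≤ m ] (δ a v * ((f a - f b) * g v)) + ∑[ v ≤ m ] (δ b v * ((f b - f a) * g v))
    ≡⟨ cong₂ _+_ (∑-δ m (λ v → (f a - f b) * g v) a≤m) (∑-δ m (λ v → (f b - f a) * g v) b≤m) ⟩
  (f a - f b) * g a + (f b - f a) * g b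
    ≡⟨ factor (f a) (f b) (g a) (g b) ⟩
  (f a - f b) * (g a - g b) ∎
  where
  open ≡-Reasoning
  distribute : ∀ x y fa fb w → (x * (fa - fb) + y * (fb - fa)) * w ≡ x * ((fa - fb) * w) + y * ((fb - fa) * w)
  distribute = solve-∀
  factor : ∀ fa fb ga gb → (fa - fb) * ga + (fb - fa) * gb ≡ (fa - fb) * (ga - gb)
  factor = solve-∀

Δ-symmetric : ∀ m {es} (f g : ℕ → ℤ) → Endpoints (ℕ._≤ m) es →
              ∑[ v ≤ m ] (Δ es f v * g v) ≡ ∑[ v ≤ m ] (Δ es g v * f v)
Δ-symmetric m f g [] = refl
Δ-symmetric m {(a , b) ∷ es} f g ((a≤m , b≤m) ∷ es≤m) = begin
  ∑[ v ≤ m ] (Δ ((a , b) ∷ es) f v * g v)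
    ≡⟨ split f g ⟩
  ∑[ v ≤ m ] (edgeΔ (a , b) f v * g v) + ∑[ v ≤ m ] (Δ es f v * g v)
    ≡⟨ cong₂ _+_ (trans (∑-edgeΔ m f g a≤m b≤m)
                   (trans (ℤₚ.*-comm (f a - f b) (g a - g b)) (sym (∑-edgeΔ m g f a≤m b≤m))))
                 (Δ-symmetric m f g es≤m) ⟩
  ∑[ v ≤ m ] (edgeΔ (a , b) g v * f v) + ∑[ v ≤ m ] (Δ es g v * f v)
    ≡⟨ split g f ⟨
  ∑[ v ≤ m ] (Δ ((a , b) ∷ es) g v * f v) ∎
  where
  open ≡-Reasoning
  split : ∀ f g → ∑[ v ≤ m ] (Δ ((a , b) ∷ es) f v * g v)
                  ≡ ∑[ v ≤ m ] (edgeΔ (a , b) f v * g v) + ∑[ v ≤ m ] (Δ es f v * g v)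
  split f g = trans (∑-cong m λ v _ → ℤₚ.*-distribʳ-+ (g v) (edgeΔ (a , b) f v) (Δ es f v))
                    (∑-+ m (λ v → edgeΔ (a , b) f v * g v) (λ v → Δ es f v * g v))

∑-Δ* : ∀ m {es} (f : ℕ → ℤ) c → Endpoints (ℕ._≤ m) es → ∑[ v ≤ m ] (Δ es f v * c) ≡ 0ℤ
∑-Δ* m {es} f c es≤m = begin
  ∑[ v ≤ m ] (Δ es f v * c)           ≡⟨ Δ-symmetric m f (λ _ → c) es≤m ⟩
  ∑[ v ≤ m ] (Δ es (λ _ → c) v * f v) ≡⟨ ∑-zero m (λ v _ → cong (_* f v) (Δ-const es c v)) ⟩
  0ℤ                                  ∎
  where open ≡-Reasoning

∑-Δδ : ∀ m {es u} (g : ℕ → ℤ) → Endpoints (ℕ._≤ m) es → u ℕ.≤ m →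
       ∑[ v ≤ m ] (Δ es (δ u) v * g v) ≡ Δ es g u
∑-Δδ m {es} {u} g es≤m u≤m = begin
  ∑[ v ≤ m ] (Δ es (δ u) v * g v)  ≡⟨ Δ-symmetric m (δ u) g es≤m ⟩
  ∑[ v ≤ m ] (Δ es g v * δ u v)    ≡⟨ ∑-cong m (λ v _ → ℤₚ.*-comm (Δ es g v) (δ u v)) ⟩
  ∑[ v ≤ m ] (δ u v * Δ es g v)    ≡⟨ ∑-δ m (Δ es g) u≤m ⟩
  Δ es g u                         ∎
  where open ≡-Reasoning

Principal : ℕ → List Edge → (ℕ → ℤ) → Set
Principal m es D = Σ (ℕ → ℤ) λ f → ∀ v → v ℕ.≤ m → D v ≡ Δ es f v

principal-zero : ∀ {m es D} → (∀ v → v ℕ.≤ m → D v ≡ 0ℤ) → Principal m es D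
principal-zero {es = es} D≡0 = (λ _ → 0ℤ) , λ v v≤m → trans (D≡0 v v≤m) (sym (Δ-const es 0ℤ v))

principal-unshift : ∀ {m es D} c g → Principal m es (λ v → D v + c * Δ es g v) → Principal m es D
principal-unshift {es = es} {D} c g (f , D+cΔg≡Δf) = (λ w → f w + - c * g w) , D≡Δ
  where
  D≡Δ : ∀ v → v ℕ.≤ _ → D v ≡ Δ es (λ w → f w + - c * g w) v
  D≡Δ v v≤m = begin
    D v                                 ≡⟨ cancel (D v) c (Δ es g v) ⟩
    D v + c * Δ es g v + - c * Δ es g v ≡⟨ cong (_+ - c * Δ es g v) (D+cΔg≡Δf v v≤m) ⟩
    Δ es f v + - c * Δ es g v           ≡⟨ Δ-linear es f g (- c) v ⟨
    Δ es (λ w → f w + - c * g w) v      ∎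
    where
    open ≡-Reasoning
    cancel : ∀ d c x → d ≡ d + c * x + - c * x
    cancel = solve-∀

i<j⇒i-j≤-1 : ∀ {i j} → i < j → i - j ≤ -1ℤ
i<j⇒i-j≤-1 {i} {j} i<j = begin
  i - j              ≡⟨ shift i j ⟩
  (1ℤ + i - j) + -1ℤ ≤⟨ ℤₚ.+-monoˡ-≤ -1ℤ (ℤₚ.i≤j⇒i-j≤0 (ℤₚ.i<j⇒suc[i]≤j i<j)) ⟩
  0ℤ + -1ℤ           ∎
  where
  open ℤₚ.≤-Reasoning
  shift : ∀ i j → i - j ≡ (1ℤ + i - j) + -1ℤ
  shift = solve-∀

record LeastMinimiser (m : ℕ) (f : ℕ → ℤ) (v : ℕ) : Set where
  field
    in-range : v ℕ.≤ m
    minimal  : ∀ u → u ℕ.≤ m → f v ≤ f u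
    least    : ∀ u → u ℕ.< v → f v < f u

leastMinimiser : ∀ m f → Σ ℕ (LeastMinimiser m f)
leastMinimiser zero    f = 0 , record { in-range = z≤n ; minimal = λ { zero _ → ℤₚ.≤-refl } ; least = λ _ () }
leastMinimiser (suc m) f with leastMinimiser m f
... | v , lm with f (suc m) ℤₚ.<? f v
...   | yes fm<fv = suc m , record { in-range = ℕₚ.≤-refl ; minimal = minimal ; least = least }
  where
  open LeastMinimiser lm using () renaming (minimal to v-minimal)
  least : ∀ u → u ℕ.< suc m → f (suc m) < f u
  least u u<1+m = ℤₚ.<-≤-trans fm<fv (v-minimal u (ℕₚ.≤-pred u<1+m))
  minimal : ∀ u → u ℕ.≤ suc m → f (suc m) ≤ f u
  minimal u u≤1+m with u ℕ.≟ suc m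
  ... | yes refl   = ℤₚ.≤-refl
  ... | no u≢1+m = ℤₚ.<⇒≤ (least u (ℕₚ.≤∧≢⇒< u≤1+m u≢1+m))
...   | no fm≮fv = v , record { in-range = ℕₚ.m≤n⇒m≤1+n in-range ; minimal = minimal′ ; least = least }
  where
  open LeastMinimiser lm
  minimal′ : ∀ u → u ℕ.≤ suc m → f v ≤ f u
  minimal′ u u≤1+m with u ℕ.≟ suc m
  ... | yes refl   = ℤₚ.≮⇒≥ fm≮fv
  ... | no u≢1+m = minimal u (ℕₚ.≤-pred (ℕₚ.≤∧≢⇒< u≤1+m u≢1+m))

toVertices : ∀ {m n} {X : List ℤ} (φ : ℕ → ℤ) → (∀ {a} → a ∈ X → Σ ℕ λ v → v ℕ.≤ m × a ≡ φ v) →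
             (as : Vec ℤ n) → VAll.All (_∈ X) as →
             Σ (Vec ℕ n) λ vs → VAll.All (ℕ._≤ m) vs × sumℤ as ≡ sumℤ (V.map φ vs)
toVertices φ vertexOf []       []            = [] , [] , refl
toVertices φ vertexOf (a ∷ as) (a∈X ∷ as∈X) with vertexOf a∈X | toVertices φ vertexOf as as∈X
... | v , v≤m , a≡φv | vs , vs≤m , ∑as≡ = v ∷ vs , v≤m ∷ vs≤m , cong₂ _+_ a≡φv ∑as≡

-- Graphs grown by attaching vertices

module AttachedGraph (p : ℕ → ℕ) (p≤ : ∀ k → p (suc (suc k)) ℕ.≤ k) where

  attach : ℕ → List Edge
  attach zero    = (0 , 1) ∷ []
  attach (suc k) = (suc k , suc (suc k)) ∷ (p (suc (suc k)) , suc (suc k)) ∷ []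

  edges : ℕ → List Edge
  edges zero    = []
  edges (suc k) = attach k ++ edges k

  p<pred : ∀ k → p (suc (suc k)) ℕ.< suc k
  p<pred k = s≤s (p≤ k)

  attach-≤ : ∀ k → Endpoints (ℕ._≤ suc k) (attach k)
  attach-≤ zero    = (z≤n , ℕₚ.≤-refl) ∷ []
  attach-≤ (suc k) = (ℕₚ.n≤1+n _ , ℕₚ.≤-refl) ∷ (ℕₚ.≤-trans (ℕₚ.<⇒≤ (p<pred k)) (ℕₚ.n≤1+n _) , ℕₚ.≤-refl) ∷ []

  edges-≤ : ∀ m → Endpoints (ℕ._≤ m) (edges m)
  edges-≤ zero    = []
  edges-≤ (suc m) = ++⁺ (attach-≤ m) (endpoints-map ℕₚ.m≤n⇒m≤1+n (edges-≤ m))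

  Δ-edges-above : ∀ {m v} f → m ℕ.< v → Δ (edges m) f v ≡ 0ℤ
  Δ-edges-above {m} f m<v =
    Δ-notIncident f (endpoints-map (λ u≤m → ℕₚ.<⇒≢ (ℕₚ.≤-<-trans u≤m m<v)) (edges-≤ m))

  Δ-edges-stable : ∀ {n m} f v → n ℕ.≤ m → (∀ k → n ℕ.≤ k → k ℕ.< m → Δ (attach k) f v ≡ 0ℤ) →
                   Δ (edges m) f v ≡ Δ (edges n) f v
  Δ-edges-stable {n} f v n≤m = go (ℕₚ.≤⇒≤′ n≤m)
    where
    go : ∀ {m} → n ≤′ m → (∀ k → n ℕ.≤ k → k ℕ.< m → Δ (attach k) f v ≡ 0ℤ) →
         Δ (edges m) f v ≡ Δ (edges n) f v
    go ≤′-refl                _        = refl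
    go (≤′-step {m} n≤′m) attach≡0 = begin
      Δ (attach m ++ edges m) f v        ≡⟨ Δ-++ (attach m) (edges m) f v ⟩
      Δ (attach m) f v + Δ (edges m) f v ≡⟨ cong₂ _+_ (attach≡0 m (ℕₚ.≤′⇒≤ n≤′m) ℕₚ.≤-refl)
                                                      (go n≤′m λ k n≤k k<m → attach≡0 k n≤k (ℕₚ.m≤n⇒m≤1+n k<m)) ⟩
      0ℤ + Δ (edges n) f v               ≡⟨ ℤₚ.+-identityˡ _ ⟩
      Δ (edges n) f v                    ∎
      where open ≡-Reasoning

  Δ-edges-antitone : ∀ {n m} f v → n ℕ.≤ m → (∀ k → n ℕ.≤ k → k ℕ.< m → Δ (attach k) f v ≤ 0ℤ) →
                     Δ (edges m) f v ≤ Δ (edges n) f v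
  Δ-edges-antitone {n} f v n≤m = go (ℕₚ.≤⇒≤′ n≤m)
    where
    go : ∀ {m} → n ≤′ m → (∀ k → n ℕ.≤ k → k ℕ.< m → Δ (attach k) f v ≤ 0ℤ) →
         Δ (edges m) f v ≤ Δ (edges n) f v
    go ≤′-refl                _        = ℤₚ.≤-refl
    go (≤′-step {m} n≤′m) attach≤0 = begin
      Δ (attach m ++ edges m) f v        ≡⟨ Δ-++ (attach m) (edges m) f v ⟩
      Δ (attach m) f v + Δ (edges m) f v ≤⟨ ℤₚ.+-mono-≤ (attach≤0 m (ℕₚ.≤′⇒≤ n≤′m) ℕₚ.≤-refl)
                                                       (go n≤′m λ k n≤k k<m → attach≤0 k n≤k (ℕₚ.m≤n⇒m≤1+n k<m)) ⟩
      0ℤ + Δ (edges n) f v               ≡⟨ ℤₚ.+-identityˡ _ ⟩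
      Δ (edges n) f v                    ∎
      where open ℤₚ.≤-Reasoning

  Δ-attach-lower : ∀ k f → Δ (attach k) f k ≡ f k - f (suc k)
  Δ-attach-lower zero    f = trans (ℤₚ.+-identityʳ _) (edgeΔ-lower f λ ())
  Δ-attach-lower (suc k) f = begin
    edgeΔ (suc k , suc (suc k)) f (suc k) + (edgeΔ (p (suc (suc k)) , suc (suc k)) f (suc k) + 0ℤ)
      ≡⟨ cong₂ (λ x y → x + (y + 0ℤ)) (edgeΔ-lower f (ℕₚ.<⇒≢ (ℕₚ.n<1+n _)))
                                       (edgeΔ-away f (ℕₚ.<⇒≢ (p<pred k)) (ℕₚ.<⇒≢ (ℕₚ.n<1+n _) ∘ sym)) ⟩
    f (suc k) - f (suc (suc k)) + (0ℤ + 0ℤ)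
      ≡⟨ ℤₚ.+-identityʳ _ ⟩
    f (suc k) - f (suc (suc k)) ∎
    where open ≡-Reasoning

  Δ-edges-next : ∀ v f → Δ (edges (suc v)) f v ≡ (f v - f (suc v)) + Δ (edges v) f v
  Δ-edges-next v f = trans (Δ-++ (attach v) (edges v) f v) (cong (λ x → x + Δ (edges v) f v) (Δ-attach-lower v f))

  Δ-attach-p : ∀ k f → Δ (attach (suc k)) f (p (suc (suc k))) ≡ f (p (suc (suc k))) - f (suc (suc k))
  Δ-attach-p k f = begin
    edgeΔ (suc k , suc (suc k)) f q + (edgeΔ (q , suc (suc k)) f q + 0ℤ)
      ≡⟨ cong₂ (λ x y → x + (y + 0ℤ)) (edgeΔ-away f (ℕₚ.<⇒≢ (p<pred k) ∘ sym) (ℕₚ.<⇒≢ (ℕₚ.m≤n⇒m≤1+n (p<pred k)) ∘ sym))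
                                       (edgeΔ-lower f (ℕₚ.<⇒≢ (ℕₚ.m≤n⇒m≤1+n (p<pred k)))) ⟩
    0ℤ + (f q - f (suc (suc k)) + 0ℤ)
      ≡⟨ trans (ℤₚ.+-identityˡ _) (ℤₚ.+-identityʳ _) ⟩
    f q - f (suc (suc k)) ∎
    where
    open ≡-Reasoning
    q : ℕ
    q = p (suc (suc k))

  Δ-edges-one : ∀ f → Δ (edges 1) f 1 ≡ f 1 - f 0
  Δ-edges-one f = trans (ℤₚ.+-identityʳ _) (edgeΔ-upper f λ ())

  Δ-edges-top : ∀ k f → Δ (edges (suc (suc k))) f (suc (suc k))
                       ≡ (f (suc (suc k)) - f (suc k)) + (f (suc (suc k)) - f (p (suc (suc k))))
  Δ-edges-top k f = begin
    Δ (attach (suc k) ++ edges (suc k)) f t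
      ≡⟨ Δ-++ (attach (suc k)) (edges (suc k)) f t ⟩
    edgeΔ (suc k , t) f t + (edgeΔ (p t , t) f t + 0ℤ) + Δ (edges (suc k)) f t
      ≡⟨ cong₂ (λ x y → x + (y + 0ℤ) + Δ (edges (suc k)) f t)
               (edgeΔ-upper f (ℕₚ.<⇒≢ (ℕₚ.n<1+n _))) (edgeΔ-upper f (ℕₚ.<⇒≢ (ℕₚ.m≤n⇒m≤1+n (p<pred k)))) ⟩
    (f t - f (suc k)) + (f t - f (p t) + 0ℤ) + Δ (edges (suc k)) f t
      ≡⟨ cong₂ (λ x y → (f t - f (suc k)) + x + y) (ℤₚ.+-identityʳ _) (Δ-edges-above {suc k} f ℕₚ.≤-refl) ⟩
    (f t - f (suc k)) + (f t - f (p t)) + 0ℤ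
      ≡⟨ ℤₚ.+-identityʳ _ ⟩
    (f t - f (suc k)) + (f t - f (p t)) ∎
    where
    open ≡-Reasoning
    t : ℕ
    t = suc (suc k)

  Δ-edges-support : ∀ {m v} g → (∀ w → v ℕ.≤ w → g w ≡ 0ℤ) → v ℕ.≤ m → Δ (edges m) g v ≡ Δ (edges v) g v
  Δ-edges-support {v = v} g g≡0 v≤m = Δ-edges-stable g v v≤m λ k v≤k _ → Δ-beyond-support g g≡0 (attach-beyond k v≤k)
    where
    attach-beyond : ∀ k → v ℕ.≤ k → All (λ e → v ℕ.< proj₂ e) (attach k)
    attach-beyond zero    v≤k = s≤s v≤k ∷ []
    attach-beyond (suc k) v≤k = s≤s v≤k ∷ s≤s v≤k ∷ []

  Δδ-top : ∀ {m u k} → u ℕ.< suc (suc k) → suc (suc k) ℕ.≤ m →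
           Δ (edges m) (δ u) (suc (suc k)) ≡ - (δ u (suc k) + δ u (p (suc (suc k))))
  Δδ-top {m} {u} {k} u<t t≤m = begin
    Δ (edges m) (δ u) t
      ≡⟨ Δ-edges-support (δ u) (λ w t≤w → δ-≢ (ℕₚ.<⇒≢ (ℕₚ.<-≤-trans u<t t≤w))) t≤m ⟩
    Δ (edges t) (δ u) t
      ≡⟨ Δ-edges-top k (δ u) ⟩
    (δ u t - δ u (suc k)) + (δ u t - δ u (p t))
      ≡⟨ cong (λ x → (x - δ u (suc k)) + (x - δ u (p t))) (δ-≢ (ℕₚ.<⇒≢ u<t)) ⟩
    (0ℤ - δ u (suc k)) + (0ℤ - δ u (p t))
      ≡⟨ simplify (δ u (suc k)) (δ u (p t)) ⟩
    - (δ u (suc k) + δ u (p t)) ∎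
    where
    open ≡-Reasoning
    t : ℕ
    t = suc (suc k)
    simplify : ∀ x y → (0ℤ - x) + (0ℤ - y) ≡ - (x + y)
    simplify = solve-∀

  -- ν v is the number of edges from v to smaller vertices, minus one: the Baker–Norine divisor
  -- of the acyclic orientation towards larger vertices.
  ν : ℕ → ℤ
  ν zero          = -1ℤ
  ν (suc zero)    = 0ℤ
  ν (suc (suc _)) = 1ℤ

  Δ-edges-self : ∀ v f → (∀ u → u ℕ.< v → f v < f u) → Δ (edges v) f v ≤ -1ℤ - ν v
  Δ-edges-self zero          f _     = ℤₚ.≤-refl
  Δ-edges-self (suc zero)    f lower = ℤₚ.≤-trans (ℤₚ.≤-reflexive (Δ-edges-one f)) (i<j⇒i-j≤-1 (lower 0 (s≤s z≤n)))
  Δ-edges-self (suc (suc k)) f lower = ℤₚ.≤-trans (ℤₚ.≤-reflexive (Δ-edges-top k f))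
    (ℤₚ.+-mono-≤ (i<j⇒i-j≤-1 (lower (suc k) ℕₚ.≤-refl))
                 (i<j⇒i-j≤-1 (lower (p (suc (suc k))) (ℕₚ.m≤n⇒m≤1+n (p<pred k)))))

  Δ-at-leastMinimiser : ∀ {m f v} → LeastMinimiser m f v → Δ (edges m) f v ≤ -1ℤ - ν v
  Δ-at-leastMinimiser {m} {f} {v} lm =
    ℤₚ.≤-trans (Δ-edges-antitone f v in-range attach≤0) (Δ-edges-self v f least)
    where
    open LeastMinimiser lm
    attach≤0 : ∀ k → v ℕ.≤ k → k ℕ.< m → Δ (attach k) f v ≤ 0ℤ
    attach≤0 k _ k<m =
      Δ-nonpos-at-minimum f v (endpoints-map (λ {u} u≤1+k → minimal u (ℕₚ.≤-trans u≤1+k k<m)) (attach-≤ k))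

  ∑-ν : ∀ w → ∑[ v ≤ suc (suc w) ] (ν v * 1ℤ) ≡ + w
  ∑-ν zero    = refl
  ∑-ν (suc w) = trans (cong (_+ 1ℤ) (∑-ν w)) (ℤₚ.+-comm (+ w) 1ℤ)

  -- If E − ν = Δ f, then at the least vertex where f is minimal each edge to a smaller vertex
  -- contributes at most −1 to Δ f, which forces E to be negative there.
  ν-not-effective : ∀ m (E : ℕ → ℤ) → (∀ v → v ℕ.≤ m → 0ℤ ≤ E v) → ¬ Principal m (edges m) (λ v → E v - ν v)
  ν-not-effective m E E≥0 (f , E-ν≡Δf) with leastMinimiser m f
  ... | v , lm = 0≰-1 (ℤₚ.≤-trans (E≥0 v in-range) Ev≤-1)
    where
    open LeastMinimiser lm using (in-range)
    0≰-1 : ¬ (0ℤ ≤ -1ℤ)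
    0≰-1 ()
    Ev≤-1 : E v ≤ -1ℤ
    Ev≤-1 = begin
      E v                    ≡⟨ split (E v) (ν v) ⟩
      (E v - ν v) + ν v      ≤⟨ ℤₚ.+-monoˡ-≤ (ν v) E-ν≤ ⟩
      (-1ℤ - ν v) + ν v      ≡⟨ split -1ℤ (ν v) ⟨
      -1ℤ                    ∎
      where
      open ℤₚ.≤-Reasoning
      split : ∀ e n → e ≡ (e - n) + n
      split = solve-∀
      E-ν≤ : E v - ν v ≤ -1ℤ - ν v
      E-ν≤ = ℤₚ.≤-trans (ℤₚ.≤-reflexive (E-ν≡Δf v in-range)) (Δ-at-leastMinimiser lm)

  -- r k is a smaller neighbour of k + 2 but of no larger vertex.
  module Reduction (M : ℕ) (1≤M : 1 ℕ.≤ M) (φ : ℕ → ℤ) (φ0 : φ 0 ≡ 0ℤ) (φ1 : φ 1 ≡ 1ℤ)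
    (r : ℕ → ℕ) (r< : ∀ k → r k ℕ.< suc (suc k))
    (r-joined : ∀ k → δ (r k) (suc k) + δ (r k) (p (suc (suc k))) ≡ 1ℤ)
    (r-unjoined : ∀ k j → k ℕ.< j → δ (r k) (suc j) + δ (r k) (p (suc (suc j))) ≡ 0ℤ)
    (φ-harmonic : ∀ k → suc (suc k) ℕ.≤ M → Δ (edges M) φ (r k) ≡ 0ℤ)
    (z : ℕ) (z≤M : z ℕ.≤ M)
    where

    ⟨_,_⟩ : (ℕ → ℤ) → (ℕ → ℤ) → ℤ
    ⟨ D , g ⟩ = ∑[ v ≤ M ] (D v * g v)

    deg : (ℕ → ℤ) → ℤ
    deg D = ⟨ D , (λ _ → 1ℤ) ⟩

    IsPrincipal : (ℕ → ℤ) → Set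
    IsPrincipal = Principal M (edges M)

    Δδr-joined : ∀ k → suc (suc k) ℕ.≤ M → Δ (edges M) (δ (r k)) (suc (suc k)) ≡ -1ℤ
    Δδr-joined k t≤M = trans (Δδ-top (r< k) t≤M) (cong -_ (r-joined k))

    Δδr-beyond : ∀ k v → suc (suc k) ℕ.< v → v ℕ.≤ M → Δ (edges M) (δ (r k)) v ≡ 0ℤ
    Δδr-beyond k (suc (suc j)) (s≤s (s≤s k<j)) v≤M =
      trans (Δδ-top (ℕₚ.<-trans (r< k) (s≤s (s≤s k<j))) v≤M) (cong -_ (r-unjoined k j k<j))

    deg-shift : ∀ D c g → deg (λ v → D v + c * Δ (edges M) g v) ≡ deg D
    deg-shift D c g = begin
      deg (λ v → D v + c * Δ (edges M) g v) ≡⟨ ∑-lincomb M D (Δ (edges M) g) (λ _ → 1ℤ) c ⟩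
      deg D + c * deg (Δ (edges M) g)       ≡⟨ cong (λ x → deg D + c * x) (∑-Δ* M g 1ℤ (edges-≤ M)) ⟩
      deg D + c * 0ℤ                        ≡⟨ cong (λ x → deg D + x) (ℤₚ.*-zeroʳ c) ⟩
      deg D + 0ℤ                            ≡⟨ ℤₚ.+-identityʳ (deg D) ⟩
      deg D                                 ∎
      where open ≡-Reasoning

    pairing-shift : ∀ D c {u} → u ℕ.≤ M →
                    ⟨ (λ v → D v + c * Δ (edges M) (δ u) v) , φ ⟩ ≡ ⟨ D , φ ⟩ + c * Δ (edges M) φ u
    pairing-shift D c {u} u≤M = trans (∑-lincomb M D (Δ (edges M) (δ u)) φ c)
      (cong (λ x → ⟨ D , φ ⟩ + c * x) (∑-Δδ M φ (edges-≤ M) u≤M))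

    principal-of-01-support : ∀ D → (∀ v → 1 ℕ.< v → v ℕ.≤ M → D v ≡ 0ℤ) →
                              deg D ≡ 0ℤ → ⟨ D , φ ⟩ ≡ 0ℤ → IsPrincipal D
    principal-of-01-support D D≡0 deg≡0 ⟨D,φ⟩≡0 = principal-zero {es = edges M} D-vanishes
      where
      D1≡0 : D 1 ≡ 0ℤ
      D1≡0 = begin
        D 1                       ≡⟨ pick (D 0) (D 1) ⟩
        D 0 * 0ℤ + D 1 * 1ℤ       ≡⟨ cong₂ (λ x y → D 0 * x + D 1 * y) φ0 φ1 ⟨
        D 0 * φ 0 + D 1 * φ 1     ≡⟨ ∑-low M (λ v → D v * φ v) 1≤M (λ v 1<v v≤M → cong (_* φ v) (D≡0 v 1<v v≤M)) ⟨
        ⟨ D , φ ⟩                 ≡⟨ ⟨D,φ⟩≡0 ⟩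
        0ℤ                        ∎
        where
        open ≡-Reasoning
        pick : ∀ x y → y ≡ x * 0ℤ + y * 1ℤ
        pick = solve-∀
      D0≡0 : D 0 ≡ 0ℤ
      D0≡0 = begin
        D 0                       ≡⟨ drop (D 0) ⟩
        D 0 * 1ℤ + 0ℤ * 1ℤ        ≡⟨ cong (λ x → D 0 * 1ℤ + x * 1ℤ) D1≡0 ⟨
        D 0 * 1ℤ + D 1 * 1ℤ       ≡⟨ ∑-low M (λ v → D v * 1ℤ) 1≤M (λ v 1<v v≤M → cong (_* 1ℤ) (D≡0 v 1<v v≤M)) ⟨
        deg D                     ≡⟨ deg≡0 ⟩
        0ℤ                        ∎
        where
        open ≡-Reasoning
        drop : ∀ x → x ≡ x * 1ℤ + 0ℤ * 1ℤ
        drop = solve-∀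
      D-vanishes : ∀ v → v ℕ.≤ M → D v ≡ 0ℤ
      D-vanishes zero          _   = D0≡0
      D-vanishes (suc zero)    _   = D1≡0
      D-vanishes (suc (suc v)) v≤M = D≡0 (suc (suc v)) (s≤s (s≤s z≤n)) v≤M

    -- Adding D (k + 2) · Δ δ_(r k) clears vertex k + 2 without changing the degree or, φ being
    -- harmonic at r k, the φ-pairing; on {0, 1} a divisor is determined by these two numbers.
    principal-of-low-support : ∀ t D → t ℕ.≤ M → (∀ v → t ℕ.< v → v ℕ.≤ M → D v ≡ 0ℤ) →
                               deg D ≡ 0ℤ → ⟨ D , φ ⟩ ≡ 0ℤ → IsPrincipal D
    principal-of-low-support zero          D _ D≡0 =
      principal-of-01-support D λ v 1<v → D≡0 v (ℕₚ.<-trans (s≤s z≤n) 1<v)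
    principal-of-low-support (suc zero)    D _ D≡0 = principal-of-01-support D D≡0
    principal-of-low-support (suc (suc k)) D t≤M D≡0 deg≡0 ⟨D,φ⟩≡0 =
      principal-unshift {es = edges M} c (δ (r k))
        (principal-of-low-support (suc k) D′ (ℕₚ.<⇒≤ t≤M) D′≡0 deg′≡0 ⟨D′,φ⟩≡0)
      where
      t : ℕ
      t = suc (suc k)
      c : ℤ
      c = D t
      D′ : ℕ → ℤ
      D′ v = D v + c * Δ (edges M) (δ (r k)) v
      r≤M : r k ℕ.≤ M
      r≤M = ℕₚ.<⇒≤ (ℕₚ.<-≤-trans (r< k) t≤M)
      D′≡0 : ∀ v → suc k ℕ.< v → v ℕ.≤ M → D′ v ≡ 0ℤ
      D′≡0 v k+1<v v≤M with v ℕ.≟ t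
      ... | yes refl = trans (cong (λ x → c + c * x) (Δδr-joined k t≤M)) (cancel c)
        where
        cancel : ∀ c → c + c * -1ℤ ≡ 0ℤ
        cancel = solve-∀
      ... | no v≢t = trans (cong₂ (λ x y → x + c * y) (D≡0 v t<v v≤M) (Δδr-beyond k v t<v v≤M))
                           (trans (ℤₚ.+-identityˡ _) (ℤₚ.*-zeroʳ c))
        where
        t<v : t ℕ.< v
        t<v = ℕₚ.≤∧≢⇒< k+1<v (v≢t ∘ sym)
      deg′≡0 : deg D′ ≡ 0ℤ
      deg′≡0 = trans (deg-shift D c (δ (r k))) deg≡0
      ⟨D′,φ⟩≡0 : ⟨ D′ , φ ⟩ ≡ 0ℤ
      ⟨D′,φ⟩≡0 = begin
        ⟨ D′ , φ ⟩                          ≡⟨ pairing-shift D c r≤M ⟩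
        ⟨ D , φ ⟩ + c * Δ (edges M) φ (r k) ≡⟨ cong₂ (λ x y → x + c * y) ⟨D,φ⟩≡0 (φ-harmonic k t≤M) ⟩
        0ℤ + c * 0ℤ                         ≡⟨ trans (ℤₚ.+-identityˡ _) (ℤₚ.*-zeroʳ c) ⟩
        0ℤ                                  ∎
        where open ≡-Reasoning

    principal-of-divisible : ∀ D → deg D ≡ 0ℤ → Δ (edges M) φ z ∣ ⟨ D , φ ⟩ → IsPrincipal D
    principal-of-divisible D deg≡0 (divides q ⟨D,φ⟩≡qΔφz) =
      principal-unshift {es = edges M} (- q) (δ z)
        (principal-of-low-support M D′ ℕₚ.≤-refl (λ v M<v v≤M → ⊥-elim (ℕₚ.<⇒≱ M<v v≤M)) deg′≡0 ⟨D′,φ⟩≡0)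
      where
      D′ : ℕ → ℤ
      D′ v = D v + - q * Δ (edges M) (δ z) v
      deg′≡0 : deg D′ ≡ 0ℤ
      deg′≡0 = trans (deg-shift D (- q) (δ z)) deg≡0
      ⟨D′,φ⟩≡0 : ⟨ D′ , φ ⟩ ≡ 0ℤ
      ⟨D′,φ⟩≡0 = begin
        ⟨ D′ , φ ⟩                                  ≡⟨ pairing-shift D (- q) z≤M ⟩
        ⟨ D , φ ⟩ + - q * Δ (edges M) φ z           ≡⟨ cong (λ x → x + - q * Δ (edges M) φ z) ⟨D,φ⟩≡qΔφz ⟩
        q * Δ (edges M) φ z + - q * Δ (edges M) φ z ≡⟨ cancel q (Δ (edges M) φ z) ⟩
        0ℤ                                          ∎
        where
        open ≡-Reasoning
        cancel : ∀ q x → q * x + - q * x ≡ 0ℤ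
        cancel = solve-∀

    ⟨ν,φ⟩-not-sum : ∀ {n} (vs : Vec ℕ n) → VAll.All (ℕ._≤ M) vs → + n ≡ deg ν →
                    ¬ (Δ (edges M) φ z ∣ ⟨ ν , φ ⟩ - sumℤ (V.map φ vs))
    ⟨ν,φ⟩-not-sum {n} vs vs≤M n≡degν Δφz∣ =
      ν-not-effective M (count vs) (λ v _ → 0≤count vs v)
        (principal-of-divisible D deg≡0 (subst (Δ (edges M) φ z ∣_) ⟨D,φ⟩≡ (∣m⇒∣-m Δφz∣)))
      where
      D : ℕ → ℤ
      D v = count vs v - ν v
      deg≡0 : deg D ≡ 0ℤ
      deg≡0 = begin
        deg D                 ≡⟨ ∑-sub M (count vs) ν (λ _ → 1ℤ) ⟩
        deg (count vs) - deg ν ≡⟨ cong (_- deg ν) (trans (∑-count M vs (λ _ → 1ℤ) vs≤M) (sumℤ-ones vs)) ⟩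
        + n - deg ν           ≡⟨ cong (λ x → + n - x) n≡degν ⟨
        + n - + n             ≡⟨ ℤₚ.+-inverseʳ (+ n) ⟩
        0ℤ                    ∎
        where open ≡-Reasoning
      ⟨D,φ⟩≡ : - (⟨ ν , φ ⟩ - sumℤ (V.map φ vs)) ≡ ⟨ D , φ ⟩
      ⟨D,φ⟩≡ = begin
        - (⟨ ν , φ ⟩ - sumℤ (V.map φ vs))   ≡⟨ flip ⟨ ν , φ ⟩ (sumℤ (V.map φ vs)) ⟩
        sumℤ (V.map φ vs) - ⟨ ν , φ ⟩       ≡⟨ cong (_- ⟨ ν , φ ⟩) (∑-count M vs φ vs≤M) ⟨
        ⟨ count vs , φ ⟩ - ⟨ ν , φ ⟩        ≡⟨ ∑-sub M (count vs) ν φ ⟨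
        ⟨ D , φ ⟩                          ∎
        where
        open ≡-Reasoning
        flip : ∀ x y → - (x - y) ≡ y - x
        flip = solve-∀

    sumset-misses-⟨ν,φ⟩ : ∀ {n} N (X : List ℤ) → + n ≡ deg ν → Δ (edges M) φ z ∣ N →
                          (∀ {a} → a ∈ X → Σ ℕ λ v → v ℕ.≤ M × a ≡ φ v) → SumsetProper N n X
    sumset-misses-⟨ν,φ⟩ N X n≡degν Δφz∣N vertexOf = ⟨ ν , φ ⟩ , unreached
      where
      unreached : ¬ InSumset N _ X ⟨ ν , φ ⟩
      unreached (as , as∈X , N∣) with toVertices φ vertexOf as as∈X
      ... | vs , vs≤M , ∑as≡ = ⟨ν,φ⟩-not-sum vs vs≤M n≡degν
        (∣-trans Δφz∣N (subst (N ∣_) (cong (λ x → ⟨ ν , φ ⟩ - x) ∑as≡) (∣ᵤ⇒∣ N∣)))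

F-add : ∀ m n → F (suc (m ℕ.+ n)) ≡ F (suc m) * F (suc n) + F m * F n
F-add zero    n = unit (F (suc n)) (F n)
  where
  unit : ∀ x y → x ≡ 1ℤ * x + 0ℤ * y
  unit = solve-∀
F-add (suc m) n = begin
  F (suc (suc m ℕ.+ n))                                ≡⟨ cong (F ∘ suc) (ℕₚ.+-suc m n) ⟨
  F (suc (m ℕ.+ suc n))                                ≡⟨ F-add m (suc n) ⟩
  F (suc m) * F (suc (suc n)) + F m * F (suc n)        ≡⟨ regroup (F (suc m)) (F m) (F (suc n)) (F n) ⟩
  F (suc (suc m)) * F (suc n) + F (suc m) * F n        ∎
  where
  open ≡-Reasoning
  regroup : ∀ a b c d → a * (c + d) + b * c ≡ (a + b) * c + a * d
  regroup = solve-∀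

F-odd : ∀ k → F (suc (2 ℕ.* k)) ≡ F (suc k) * F (suc k) + F k * F k
F-odd k = trans (cong (λ x → F (suc (k ℕ.+ x))) (ℕₚ.+-identityʳ k)) (F-add k k)

F-even : ∀ k → F (2 ℕ.* suc k) ≡ F (suc k) * (F (suc k) + F k + F k)
F-even k = begin
  F (2 ℕ.* suc k)                           ≡⟨ cong (λ x → F (suc (k ℕ.+ x))) (ℕₚ.+-identityʳ (suc k)) ⟩
  F (suc (k ℕ.+ suc k))                     ≡⟨ F-add k (suc k) ⟩
  F (suc k) * (F (suc k) + F k) + F k * F (suc k) ≡⟨ regroup (F (suc k)) (F k) ⟩
  F (suc k) * (F (suc k) + F k + F k)       ∎
  where
  open ≡-Reasoning
  regroup : ∀ b a → b * (b + a) + a * b ≡ b * (b + a + a)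
  regroup = solve-∀

F-2*suc : ∀ k → F (2 ℕ.* suc k) ≡ F (2 ℕ.+ 2 ℕ.* k)
F-2*suc k = cong F (ℕₚ.*-suc 2 k)

sign-sq : ∀ k → sign k * sign k ≡ 1ℤ
sign-sq zero    = refl
sign-sq (suc k) = trans (neg-sq (sign k)) (sign-sq k)
  where
  neg-sq : ∀ s → - s * - s ≡ s * s
  neg-sq = solve-∀

sign-cases : ∀ k → sign k ≡ 1ℤ ⊎ sign k ≡ -1ℤ
sign-cases zero    = inj₁ refl
sign-cases (suc k) with sign-cases k
... | inj₁ s≡1  = inj₂ (cong -_ s≡1)
... | inj₂ s≡-1 = inj₁ (cong -_ s≡-1)

sign-+ : ∀ i j → sign (i ℕ.+ j) ≡ sign i * sign j
sign-+ zero    j = sym (ℤₚ.*-identityˡ (sign j))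
sign-+ (suc i) j = trans (cong -_ (sign-+ i j)) (ℤₚ.neg-distribˡ-* (sign i) (sign j))

catalan : ∀ k r → F (k ℕ.+ r) * F (k ℕ.+ r) - F k * F (k ℕ.+ (r ℕ.+ r)) ≡ sign k * (F r * F r)
catalan zero    r = drop-zero (F r * F r) (F (r ℕ.+ r))
  where
  drop-zero : ∀ x y → x - 0ℤ * y ≡ 1ℤ * x
  drop-zero = solve-∀
catalan (suc k) r = begin
  a * a - p * c                                  ≡⟨ regroup a b p c q d ⟩
  (a * a + b * b) - (p * c + q * d) - (b * b - q * d)
    ≡⟨ cong₂ (λ x y → x - y - (b * b - q * d)) (F-add (k ℕ.+ r) (k ℕ.+ r)) (F-add k (k ℕ.+ (r ℕ.+ r))) ⟨
  F (suc (k ℕ.+ r ℕ.+ (k ℕ.+ r))) - F (suc (k ℕ.+ (k ℕ.+ (r ℕ.+ r)))) - (b * b - q * d)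
    ≡⟨ cong₂ (λ i x → F (suc i) - F (suc (k ℕ.+ (k ℕ.+ (r ℕ.+ r)))) - x) (reindex k r) (catalan k r) ⟩
  t - t - sign k * (F r * F r)                   ≡⟨ cancel t (sign k * (F r * F r)) ⟩
  - (sign k * (F r * F r))                       ≡⟨ ℤₚ.neg-distribˡ-* (sign k) (F r * F r) ⟩
  sign (suc k) * (F r * F r)                     ∎
  where
  open ≡-Reasoning
  a b p c q d t : ℤ
  a = F (suc k ℕ.+ r)
  b = F (k ℕ.+ r)
  p = F (suc k)
  c = F (suc k ℕ.+ (r ℕ.+ r))
  q = F k
  d = F (k ℕ.+ (r ℕ.+ r))
  t = F (suc (k ℕ.+ (k ℕ.+ (r ℕ.+ r))))
  regroup : ∀ a b p c q d → a * a - p * c ≡ (a * a + b * b) - (p * c + q * d) - (b * b - q * d)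
  regroup = solve-∀
  reindex : ∀ k r → k ℕ.+ r ℕ.+ (k ℕ.+ r) ≡ k ℕ.+ (k ℕ.+ (r ℕ.+ r))
  reindex = ℕ-Solver.solve-∀
  cancel : ∀ t x → t - t - x ≡ - x
  cancel = solve-∀

unit-square : ∀ s → s * s ≡ 1ℤ → ∀ y → s * (s * y) ≡ y
unit-square s s²≡1 y = trans (sym (ℤₚ.*-assoc s s y)) (trans (cong (_* y) s²≡1) (ℤₚ.*-identityˡ y))

-- The fan and the triangle strip

module Fan where

  open AttachedGraph (λ _ → 0) (λ _ → z≤n)

  φ : ℕ → ℤ
  φ zero    = 0ℤ
  φ (suc j) = F (suc (2 ℕ.* j))

  φ-shift : ∀ i j → φ (suc (i ℕ.+ j)) ≡ F (suc (2 ℕ.* i ℕ.+ 2 ℕ.* j))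
  φ-shift i j = cong (F ∘ suc) (ℕₚ.*-distribˡ-+ 2 i j)

  Δ-hub : ∀ m → Δ (edges m) φ 0 ≡ - F (2 ℕ.* m)
  Δ-hub zero    = refl
  Δ-hub (suc k) = begin
    Δ (attach k ++ edges k) φ 0               ≡⟨ Δ-++ (attach k) (edges k) φ 0 ⟩
    Δ (attach k) φ 0 + Δ (edges k) φ 0        ≡⟨ cong₂ _+_ (spoke k) (Δ-hub k) ⟩
    (0ℤ - F (1 ℕ.+ 2 ℕ.* k)) + - F (2 ℕ.* k)  ≡⟨ merge (F (1 ℕ.+ 2 ℕ.* k)) (F (2 ℕ.* k)) ⟩
    - F (2 ℕ.+ 2 ℕ.* k)                       ≡⟨ cong -_ (F-2*suc k) ⟨
    - F (2 ℕ.* suc k)                         ∎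
    where
    open ≡-Reasoning
    spoke : ∀ k → Δ (attach k) φ 0 ≡ φ 0 - φ (suc k)
    spoke zero    = Δ-attach-lower 0 φ
    spoke (suc k) = Δ-attach-p k φ
    merge : ∀ x y → (0ℤ - x) + - y ≡ - (x + y)
    merge = solve-∀

  harmonic : ∀ {m} k → suc (suc k) ℕ.≤ m → Δ (edges m) φ (suc k) ≡ 0ℤ
  harmonic {m} k t≤m = trans (Δ-edges-stable φ (suc k) t≤m untouched) (local k)
    where
    untouched : ∀ j → suc (suc k) ℕ.≤ j → j ℕ.< m → Δ (attach j) φ (suc k) ≡ 0ℤ
    untouched (suc j) (s≤s k<j) _ = Δ-notIncident φ
      ((ℕₚ.>⇒≢ (s≤s k<j) , ℕₚ.>⇒≢ (s≤s (ℕₚ.m≤n⇒m≤1+n k<j))) ∷ (ℕₚ.0≢1+n , ℕₚ.>⇒≢ (s≤s (ℕₚ.m≤n⇒m≤1+n k<j))) ∷ [])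
    local : ∀ k → Δ (edges (suc (suc k))) φ (suc k) ≡ 0ℤ
    local zero    = refl
    local (suc j) = begin
      Δ (edges (3 ℕ.+ j)) φ (2 ℕ.+ j)
        ≡⟨ Δ-edges-next (2 ℕ.+ j) φ ⟩
      (φ (2 ℕ.+ j) - φ (3 ℕ.+ j)) + Δ (edges (2 ℕ.+ j)) φ (2 ℕ.+ j)
        ≡⟨ cong (λ x → (φ (2 ℕ.+ j) - φ (3 ℕ.+ j)) + x) (Δ-edges-top j φ) ⟩
      (φ (2 ℕ.+ j) - φ (3 ℕ.+ j)) + ((φ (2 ℕ.+ j) - φ (1 ℕ.+ j)) + (φ (2 ℕ.+ j) - φ 0))
        ≡⟨ cong₂ (λ x y → (x - y) + ((x - φ (1 ℕ.+ j)) + (x - 0ℤ))) (φ-shift 1 j) (φ-shift 2 j) ⟩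
      (F (3 ℕ.+ t) - F (5 ℕ.+ t)) + ((F (3 ℕ.+ t) - F (1 ℕ.+ t)) + (F (3 ℕ.+ t) - 0ℤ))
        ≡⟨ fibonacci (F t) (F (1 ℕ.+ t)) ⟩
      0ℤ ∎
      where
      open ≡-Reasoning
      t : ℕ
      t = 2 ℕ.* j
      fibonacci : ∀ a b → let c = b + a + b in (c - (c + (b + a) + c)) + ((c - b) + (c - 0ℤ)) ≡ 0ℤ
      fibonacci = solve-∀

  vertex : ∀ {m a} → a ∈ A₁ m → Σ ℕ λ v → v ℕ.≤ m × a ≡ φ v
  vertex (here a≡0) = 0 , z≤n , a≡0
  vertex (there a∈) with ∈-map⁻ (λ j → F (suc (2 ℕ.* j))) a∈
  ... | j , j∈upTo , a≡ = suc j , ∈-upTo⁻ j∈upTo , a≡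

  A₁-proper : ∀ w → SumsetProper (modulus (suc (suc w))) w (A₁ (suc (suc w)))
  A₁-proper w = sumset-misses-⟨ν,φ⟩ (modulus M) (A₁ M) (sym (∑-ν w)) Δφ0∣N vertex
    where
    M : ℕ
    M = suc (suc w)
    open Reduction M (s≤s z≤n) φ refl refl suc (λ k → ℕₚ.n<1+n (suc k))
      (λ k → trans (ℤₚ.+-identityʳ _) (δ-refl k))
      (λ k j k<j → trans (ℤₚ.+-identityʳ _) (δ-≢ (ℕₚ.<⇒≢ k<j)))
      harmonic 0 z≤n
    Δφ0∣N : Δ (edges M) φ 0 ∣ modulus M
    Δφ0∣N = divides -1ℤ (trans (neg-neg (modulus M)) (cong (-1ℤ *_) (sym (Δ-hub M))))
      where
      neg-neg : ∀ x → x ≡ -1ℤ * - x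
      neg-neg = solve-∀

module Strip where

  open AttachedGraph (λ v → v ∸ 2) (λ _ → ℕₚ.≤-refl)

  φ : ℕ → ℤ
  φ v = sign (suc v) * (F v * F v)

  Δ-top-vertex : ∀ w → Δ (edges (2 ℕ.+ w)) φ (2 ℕ.+ w) ≡ sign (3 ℕ.+ w) * F (2 ℕ.* (2 ℕ.+ w))
  Δ-top-vertex w = begin
    Δ (edges (2 ℕ.+ w)) φ (2 ℕ.+ w)                             ≡⟨ Δ-edges-top w φ ⟩
    (φ (2 ℕ.+ w) - φ (1 ℕ.+ w)) + (φ (2 ℕ.+ w) - φ w)           ≡⟨ fibonacci (sign w) (F w) (F (1 ℕ.+ w)) ⟩
    sign (3 ℕ.+ w) * (F (2 ℕ.+ w) * (F (2 ℕ.+ w) + F (1 ℕ.+ w) + F (1 ℕ.+ w)))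
                                                                ≡⟨ cong (λ x → sign (3 ℕ.+ w) * x) (F-even (suc w)) ⟨
    sign (3 ℕ.+ w) * F (2 ℕ.* (2 ℕ.+ w))                        ∎
    where
    open ≡-Reasoning
    fibonacci : ∀ s a b → let c = b + a in
      ((- - - s) * (c * c) - (- - s) * (b * b)) + ((- - - s) * (c * c) - (- s) * (a * a))
        ≡ - - - s * (c * (c + b + b))
    fibonacci = solve-∀

  harmonic : ∀ {m} k → suc (suc k) ℕ.≤ m → Δ (edges m) φ k ≡ 0ℤ
  harmonic {m} k t≤m = trans (Δ-edges-stable φ k t≤m untouched) (local k)
    where
    untouched : ∀ j → suc (suc k) ℕ.≤ j → j ℕ.< m → Δ (attach j) φ k ≡ 0ℤ
    untouched (suc j) (s≤s k<j) _ = Δ-notIncident φ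
      ((ℕₚ.>⇒≢ k<1+j , ℕₚ.>⇒≢ (ℕₚ.m<n⇒m<1+n k<1+j)) ∷ (ℕₚ.>⇒≢ k<j , ℕₚ.>⇒≢ (ℕₚ.m<n⇒m<1+n k<1+j)) ∷ [])
      where
      k<1+j : k ℕ.< suc j
      k<1+j = ℕₚ.m<n⇒m<1+n k<j
    local : ∀ k → Δ (edges (2 ℕ.+ k)) φ k ≡ 0ℤ
    local zero          = refl
    local (suc zero)    = refl
    local (suc (suc j)) = begin
      Δ (edges (4 ℕ.+ j)) φ u
        ≡⟨ Δ-++ (attach (3 ℕ.+ j)) (edges (3 ℕ.+ j)) φ u ⟩
      Δ (attach (3 ℕ.+ j)) φ u + Δ (edges (3 ℕ.+ j)) φ u
        ≡⟨ cong₂ _+_ (Δ-attach-p (2 ℕ.+ j) φ) (Δ-edges-next u φ) ⟩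
      (φ u - φ (2 ℕ.+ u)) + ((φ u - φ (1 ℕ.+ u)) + Δ (edges u) φ u)
        ≡⟨ cong (λ x → (φ u - φ (2 ℕ.+ u)) + ((φ u - φ (1 ℕ.+ u)) + x)) (Δ-edges-top j φ) ⟩
      (φ u - φ (2 ℕ.+ u)) + ((φ u - φ (1 ℕ.+ u)) + ((φ u - φ (1 ℕ.+ j)) + (φ u - φ j)))
        ≡⟨ fibonacci (sign j) (F j) (F (1 ℕ.+ j)) ⟩
      0ℤ ∎
      where
      open ≡-Reasoning
      u : ℕ
      u = 2 ℕ.+ j
      fibonacci : ∀ s a b → let c = b + a ; d = c + b ; e = d + c in
        ((- - - s) * (c * c) - (- - - - - s) * (e * e))
          + (((- - - s) * (c * c) - (- - - - s) * (d * d))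
          + (((- - - s) * (c * c) - (- - s) * (b * b)) + ((- - - s) * (c * c) - (- s) * (a * a))))
          ≡ 0ℤ
      fibonacci = solve-∀

  vertex : ∀ {m a} → a ∈ B m → Σ ℕ λ v → v ℕ.≤ m × a ≡ φ v
  vertex a∈ with ∈-map⁻ φ a∈
  ... | v , v∈upTo , a≡ = v , ℕₚ.≤-pred (∈-upTo⁻ v∈upTo) , a≡

  B-proper : ∀ w → SumsetProper (modulus (suc (suc w))) w (B (suc (suc w)))
  B-proper w = sumset-misses-⟨ν,φ⟩ (modulus M) (B M) (sym (∑-ν w)) ΔφM∣N vertex
    where
    M : ℕ
    M = suc (suc w)
    open Reduction M (s≤s z≤n) φ refl refl (λ k → k) (λ k → s≤s (ℕₚ.n≤1+n k))
      (λ k → cong₂ _+_ (δ-≢ (ℕₚ.<⇒≢ (ℕₚ.n<1+n k))) (δ-refl k))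
      (λ k j k<j → cong₂ _+_ (δ-≢ (ℕₚ.<⇒≢ (ℕₚ.m≤n⇒m≤1+n k<j))) (δ-≢ (ℕₚ.<⇒≢ k<j)))
      harmonic M ℕₚ.≤-refl
    ΔφM∣N : Δ (edges M) φ M ∣ modulus M
    ΔφM∣N = divides (sign (3 ℕ.+ w)) (begin
      modulus M                                    ≡⟨ unit-square (sign (3 ℕ.+ w)) (sign-sq (3 ℕ.+ w)) (modulus M) ⟨
      sign (3 ℕ.+ w) * (sign (3 ℕ.+ w) * modulus M) ≡⟨ cong (λ x → sign (3 ℕ.+ w) * x) (Δ-top-vertex w) ⟨
      sign (3 ℕ.+ w) * Δ (edges M) φ M             ∎)
      where open ≡-Reasoning

-- Covering intervals by sums

Represents : ℕ → List ℤ → ℤ → Set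
Represents m X x = Σ (Vec ℤ m) λ as → VAll.All (_∈ X) as × sumℤ as ≡ x

Covers : ℕ → List ℤ → ℤ → ℤ → Set
Covers m X lo hi = ∀ x → lo ≤ x → x < hi → Represents m X x

covers-empty-sum : ∀ {X} → Covers 0 X 0ℤ 1ℤ
covers-empty-sum x 0≤x x<1 = [] , [] , ℤₚ.≤-antisym 0≤x (ℤₚ.i<j⇒i≤pred[j] x<1)

covers-⊆ : ∀ {m X Y lo hi} → (∀ {a} → a ∈ X → a ∈ Y) → Covers m X lo hi → Covers m Y lo hi
covers-⊆ X⊆Y cover x lo≤x x<hi with cover x lo≤x x<hi
... | as , as∈X , ∑as≡x = as , VAll.map X⊆Y as∈X , ∑as≡x

represents-∷ : ∀ {m X a y} → a ∈ X → Represents m X y → Represents (suc m) X (a + y)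
represents-∷ {a = a} a∈X (as , as∈X , ∑as≡y) = a ∷ as , a∈X ∷ as∈X , cong (λ t → a + t) ∑as≡y

covers-shift : ∀ {m X lo hi a} → a ∈ X → Covers m X lo hi → Covers (suc m) X (a + lo) (a + hi)
covers-shift {m} {X} {lo} {hi} {a} a∈X cover x a+lo≤x x<a+hi =
  subst (Represents (suc m) X) (restore a x) (represents-∷ a∈X (cover (x - a) lo≤x-a x-a<hi))
  where
  unshift : ∀ a y → a + y - a ≡ y
  unshift = solve-∀
  restore : ∀ a x → a + (x - a) ≡ x
  restore = solve-∀
  lo≤x-a : lo ≤ x - a
  lo≤x-a = ℤₚ.≤-trans (ℤₚ.≤-reflexive (sym (unshift a lo))) (ℤₚ.+-monoˡ-≤ (- a) a+lo≤x)
  x-a<hi : x - a < hi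
  x-a<hi = ℤₚ.<-≤-trans (ℤₚ.+-monoˡ-< (- a) x<a+hi) (ℤₚ.≤-reflexive (unshift a hi))

covers-∪ : ∀ {m X lo mid mid′ hi} → Covers m X lo mid → Covers m X mid′ hi → mid′ ≤ mid → Covers m X lo hi
covers-∪ {mid′ = mid′} below above mid′≤mid x lo≤x x<hi with x ℤₚ.<? mid′
... | yes x<mid′ = below x lo≤x (ℤₚ.<-≤-trans x<mid′ mid′≤mid)
... | no x≮mid′  = above x (ℤₚ.≮⇒≥ x≮mid′) x<hi

represents⇒inSumset : ∀ {N m X x y} → Represents m X y → N ∣ x - y → InSumset N m X x
represents⇒inSumset (as , as∈X , refl) N∣x-y = as , as∈X , ∣⇒∣ᵤ N∣x-y

covers⇒full : ∀ {m X lo} d .{{_ : ℕ.NonZero d}} → Covers m X lo (lo + + d) → SumsetFull (+ d) m X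
covers⇒full {lo = lo} d cover x =
  represents⇒inSumset {x = x} (cover (lo + + r) (ℤₚ.i≤i+j lo (+ r)) (ℤₚ.+-monoʳ-< lo (ℤ.+<+ (n%ℕd<d (x - lo) d))))
    (divides ((x - lo) /ℕ d) (begin
      x - (lo + + r)                  ≡⟨ regroup x lo (+ r) ⟩
      (x - lo) - + r                  ≡⟨ cong (λ y → y - + r) (a≡a%ℕn+[a/ℕn]*n (x - lo) d) ⟩
      + r + (x - lo) /ℕ d * + d - + r ≡⟨ cancel (+ r) ((x - lo) /ℕ d * + d) ⟩
      (x - lo) /ℕ d * + d             ∎))
  where
  open ≡-Reasoning
  r : ℕ
  r = (x - lo) %ℕ d
  regroup : ∀ x lo r → x - (lo + r) ≡ (x - lo) - r
  regroup = solve-∀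
  cancel : ∀ r q → r + q - r ≡ q
  cancel = solve-∀

∈-map-upTo-suc : ∀ {f : ℕ → ℤ} {n a} → a ∈ map f (upTo n) → a ∈ map f (upTo (suc n))
∈-map-upTo-suc {f} a∈ with ∈-map⁻ f a∈
... | j , j∈upTo , refl = ∈-map⁺ f (∈-upTo⁺ (ℕₚ.m≤n⇒m≤1+n (∈-upTo⁻ j∈upTo)))

A₁-⊆ : ∀ {n a} → a ∈ A₁ n → a ∈ A₁ (suc n)
A₁-⊆ (here a≡0) = here a≡0
A₁-⊆ (there a∈) = there (∈-map-upTo-suc a∈)

odd∈A₁ : ∀ {n j} → j ℕ.< n → F (suc (2 ℕ.* j)) ∈ A₁ n
odd∈A₁ j<n = there (∈-map⁺ (λ j → F (suc (2 ℕ.* j))) (∈-upTo⁺ j<n))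

A₁-covers : ∀ k → Covers k (A₁ (suc k)) 0ℤ (F (2 ℕ.* suc k))
A₁-covers zero    = covers-empty-sum
A₁-covers (suc k) =
  subst (Covers (suc k) X 0ℤ) hi≡ (covers-∪ (covers-∪ (shift (here refl)) (shift q₁∈) q₁≤L) (shift q₂∈) q₂≤q₁+L)
  where
  t : ℕ
  t = 2 ℕ.* k
  X : List ℤ
  X = A₁ (suc (suc k))
  L : ℤ
  L = F (2 ℕ.+ t)
  shift : ∀ {q} → q ∈ X → Covers (suc k) X (q + 0ℤ) (q + L)
  shift q∈X = covers-shift q∈X (subst (Covers k X 0ℤ) (F-2*suc k) (covers-⊆ A₁-⊆ (A₁-covers k)))
  q₁∈ : F (1 ℕ.+ t) ∈ X
  q₁∈ = odd∈A₁ (ℕₚ.m≤n⇒m≤1+n (ℕₚ.n<1+n k))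
  q₂∈ : F (3 ℕ.+ t) ∈ X
  q₂∈ = subst (_∈ X) (cong (F ∘ suc) (ℕₚ.*-suc 2 k)) (odd∈A₁ (ℕₚ.n<1+n (suc k)))
  q₁≤L : F (1 ℕ.+ t) + 0ℤ ≤ 0ℤ + L
  q₁≤L = ℤ.+≤+ (ℕₚ.+-monoʳ-≤ (fib (1 ℕ.+ t)) z≤n)
  q₂≤q₁+L : F (3 ℕ.+ t) + 0ℤ ≤ F (1 ℕ.+ t) + L
  q₂≤q₁+L = ℤ.+≤+ (ℕₚ.≤-reflexive (trans (ℕₚ.+-identityʳ _) (ℕₚ.+-comm (fib (2 ℕ.+ t)) (fib (1 ℕ.+ t)))))
  hi≡ : F (3 ℕ.+ t) + L ≡ F (2 ℕ.* suc (suc k))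
  hi≡ = sym (trans (F-2*suc (suc k)) (cong (λ i → F (2 ℕ.+ i)) (ℕₚ.*-suc 2 k)))

φB∈B : ∀ {n j} → j ℕ.≤ n → Strip.φ j ∈ B n
φB∈B j≤n = ∈-map⁺ Strip.φ (∈-upTo⁺ (s≤s j≤n))

0≤F*F : ∀ i j → 0ℤ ≤ F i * F j
0≤F*F i j = subst (0ℤ ≤_) (ℤₚ.pos-* (fib i) (fib j)) (ℤ.+≤+ z≤n)

0≤j⇒i≤i+j : ∀ {x y} → 0ℤ ≤ y → x ≤ x + y
0≤j⇒i≤i+j {x} 0≤y = ℤₚ.≤-trans (ℤₚ.≤-reflexive (sym (ℤₚ.+-identityʳ x))) (ℤₚ.+-monoʳ-≤ x 0≤y)

module B-extension (k : ℕ) where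

  a b c L : ℤ
  a = F k
  b = F (suc k)
  c = F (suc (suc k))
  L = F (2 ℕ.* suc k)

  X : List ℤ
  X = B (suc (suc k))

  a²≤L : a * a ≤ L
  a²≤L = ℤₚ.≤-trans (0≤j⇒i≤i+j (ℤₚ.+-mono-≤ (0≤F*F (suc k) (suc k)) (ℤ.+≤+ z≤n))) (ℤₚ.≤-reflexive (begin
    a * a + (b * b + F (2 ℕ.* k)) ≡⟨ swap (a * a) (b * b) (F (2 ℕ.* k)) ⟩
    b * b + a * a + F (2 ℕ.* k)   ≡⟨ cong (λ x → x + F (2 ℕ.* k)) (F-odd k) ⟨
    F (2 ℕ.+ 2 ℕ.* k)             ≡⟨ F-2*suc k ⟨
    L                             ∎))
    where
    open ≡-Reasoning
    swap : ∀ x y z → x + (y + z) ≡ y + x + z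
    swap = solve-∀

  b²≤L : b * b ≤ L
  b²≤L = ℤₚ.≤-trans (0≤j⇒i≤i+j (ℤₚ.+-mono-≤ (0≤F*F k k) (ℤ.+≤+ z≤n))) (ℤₚ.≤-reflexive (begin
    b * b + (a * a + F (2 ℕ.* k)) ≡⟨ ℤₚ.+-assoc (b * b) (a * a) (F (2 ℕ.* k)) ⟨
    b * b + a * a + F (2 ℕ.* k)   ≡⟨ cong (λ x → x + F (2 ℕ.* k)) (F-odd k) ⟨
    F (2 ℕ.+ 2 ℕ.* k)             ≡⟨ F-2*suc k ⟨
    L                             ∎))
    where open ≡-Reasoning

  c²-a²≡L : c * c - a * a ≡ L
  c²-a²≡L = trans (square-difference a b) (sym (F-even k))
    where
    square-difference : ∀ a b → (b + a) * (b + a) - a * a ≡ b * (b + a + a)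
    square-difference = solve-∀

  F-2*[2+k] : F (2 ℕ.* suc (suc k)) ≡ c * c + b * b + L
  F-2*[2+k] = trans (F-even (suc k)) (trans (expand a b) (cong (λ x → c * c + b * b + x) (sym (F-even k))))
    where
    expand : ∀ a b → (b + a) * ((b + a) + b + b) ≡ (b + a) * (b + a) + b * b + b * (b + a + a)
    expand = solve-∀

  member : ∀ j {e} → j ℕ.≤ suc (suc k) → Strip.φ j ≡ e → e ∈ X
  member j j≤ φj≡e = subst (_∈ X) φj≡e (φB∈B j≤)

  0∈X : 0ℤ ∈ X
  0∈X = member 0 z≤n refl

  k≤2+k : k ℕ.≤ suc (suc k)
  k≤2+k = ℕₚ.m≤n⇒m≤1+n (ℕₚ.n≤1+n k)

  module _ {lo : ℤ} (cover : Covers k (B (suc k)) lo (lo + L)) where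

    shift : ∀ {e} → e ∈ X → Covers (suc k) X (e + lo) (e + (lo + L))
    shift e∈X = covers-shift e∈X (covers-⊆ ∈-map-upTo-suc cover)

    gap : ∀ e e′ → e′ - e ≤ L → e′ + lo ≤ e + (lo + L)
    gap e e′ e′-e≤L = begin
      e′ + lo           ≡⟨ regroup e e′ lo ⟩
      e + (e′ - e) + lo ≤⟨ ℤₚ.+-monoˡ-≤ lo (ℤₚ.+-monoʳ-≤ e e′-e≤L) ⟩
      e + L + lo        ≡⟨ ℤₚ.+-assoc e L lo ⟩
      e + (L + lo)      ≡⟨ cong (λ x → e + x) (ℤₚ.+-comm L lo) ⟩
      e + (lo + L)      ∎
      where
      open ℤₚ.≤-Reasoning
      regroup : ∀ e e′ lo → e′ + lo ≡ e + (e′ - e) + lo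
      regroup = solve-∀

    minus-neg : ∀ x → 0ℤ - - x ≡ x
    minus-neg = solve-∀

    extend : sign (suc k) ≡ 1ℤ ⊎ sign (suc k) ≡ -1ℤ →
             Σ ℤ λ lo′ → Covers (suc k) X lo′ (lo′ + F (2 ℕ.* suc (suc k)))
    extend (inj₁ s≡1) = - (b * b) + lo ,
      subst (Covers (suc k) X (- (b * b) + lo)) hi≡
        (covers-∪ (covers-∪ (covers-∪ (shift -b²∈) (shift 0∈X) gap₁) (shift a²∈) gap₂) (shift c²∈) gap₃)
      where
      -b²∈ : - (b * b) ∈ X
      -b²∈ = member (suc k) (ℕₚ.n≤1+n _) (trans (cong (λ s → - s * (b * b)) s≡1) (ℤₚ.-1*i≡-i (b * b)))
      a²∈ : a * a ∈ X
      a²∈ = member k k≤2+k (trans (cong (_* (a * a)) s≡1) (ℤₚ.*-identityˡ (a * a)))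
      c²∈ : c * c ∈ X
      c²∈ = member (suc (suc k)) ℕₚ.≤-refl (trans (cong (λ s → - - s * (c * c)) s≡1) (ℤₚ.*-identityˡ (c * c)))
      gap₁ : 0ℤ + lo ≤ - (b * b) + (lo + L)
      gap₁ = gap (- (b * b)) 0ℤ (ℤₚ.≤-trans (ℤₚ.≤-reflexive (minus-neg (b * b))) b²≤L)
      gap₂ : a * a + lo ≤ 0ℤ + (lo + L)
      gap₂ = gap 0ℤ (a * a) (ℤₚ.≤-trans (ℤₚ.≤-reflexive (ℤₚ.+-identityʳ (a * a))) a²≤L)
      gap₃ : c * c + lo ≤ a * a + (lo + L)
      gap₃ = gap (a * a) (c * c) (ℤₚ.≤-reflexive c²-a²≡L)
      hi≡ : c * c + (lo + L) ≡ - (b * b) + lo + F (2 ℕ.* suc (suc k))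
      hi≡ = trans (regroup (c * c) (b * b) lo L) (cong (λ x → - (b * b) + lo + x) (sym F-2*[2+k]))
        where
        regroup : ∀ x y lo L → x + (lo + L) ≡ - y + lo + (x + y + L)
        regroup = solve-∀
    extend (inj₂ s≡-1) = - (c * c) + lo ,
      subst (Covers (suc k) X (- (c * c) + lo)) hi≡
        (covers-∪ (covers-∪ (covers-∪ (shift -c²∈) (shift -a²∈) gap₁) (shift 0∈X) gap₂) (shift b²∈) gap₃)
      where
      -c²∈ : - (c * c) ∈ X
      -c²∈ = member (suc (suc k)) ℕₚ.≤-refl (trans (cong (λ s → - - s * (c * c)) s≡-1) (ℤₚ.-1*i≡-i (c * c)))
      -a²∈ : - (a * a) ∈ X
      -a²∈ = member k k≤2+k (trans (cong (_* (a * a)) s≡-1) (ℤₚ.-1*i≡-i (a * a)))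
      b²∈ : b * b ∈ X
      b²∈ = member (suc k) (ℕₚ.n≤1+n _) (trans (cong (λ s → - s * (b * b)) s≡-1) (ℤₚ.*-identityˡ (b * b)))
      flip : ∀ x y → - x - - y ≡ y - x
      flip = solve-∀
      gap₁ : - (a * a) + lo ≤ - (c * c) + (lo + L)
      gap₁ = gap (- (c * c)) (- (a * a)) (ℤₚ.≤-reflexive (trans (flip (a * a) (c * c)) c²-a²≡L))
      gap₂ : 0ℤ + lo ≤ - (a * a) + (lo + L)
      gap₂ = gap (- (a * a)) 0ℤ (ℤₚ.≤-trans (ℤₚ.≤-reflexive (minus-neg (a * a))) a²≤L)
      gap₃ : b * b + lo ≤ 0ℤ + (lo + L)
      gap₃ = gap 0ℤ (b * b) (ℤₚ.≤-trans (ℤₚ.≤-reflexive (ℤₚ.+-identityʳ (b * b))) b²≤L)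
      hi≡ : b * b + (lo + L) ≡ - (c * c) + lo + F (2 ℕ.* suc (suc k))
      hi≡ = trans (regroup (c * c) (b * b) lo L) (cong (λ x → - (c * c) + lo + x) (sym F-2*[2+k]))
        where
        regroup : ∀ x y lo L → y + (lo + L) ≡ - x + lo + (x + y + L)
        regroup = solve-∀

B-covers : ∀ k → Σ ℤ λ lo → Covers k (B (suc k)) lo (lo + F (2 ℕ.* suc k))
B-covers zero    = 0ℤ , covers-empty-sum
B-covers (suc k) = B-extension.extend k (proj₂ (B-covers k)) (sign-cases (suc k))

fib-suc-pos : ∀ j → 0 ℕ.< fib (suc j)
fib-suc-pos zero    = s≤s z≤n
fib-suc-pos (suc j) = ℕₚ.<-≤-trans (fib-suc-pos j) (ℕₚ.m≤m+n (fib (suc j)) (fib j))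

fib-2*suc-nonZero : ∀ k → ℕ.NonZero (fib (2 ℕ.* suc k))
fib-2*suc-nonZero k = subst (ℕ.NonZero ∘ fib) (sym (ℕₚ.*-suc 2 k)) (ℕ.>-nonZero (fib-suc-pos (suc (2 ℕ.* k))))

A₁-full : ∀ k → SumsetFull (modulus (suc k)) k (A₁ (suc k))
A₁-full k = covers⇒full (fib (2 ℕ.* suc k)) {{fib-2*suc-nonZero k}} (A₁-covers k)

B-full : ∀ k → SumsetFull (modulus (suc k)) k (B (suc k))
B-full k = covers⇒full (fib (2 ℕ.* suc k)) {{fib-2*suc-nonZero k}} (proj₂ (B-covers k))

-- A₂ as an affine image of B

A₂-element : ∀ {n j} → j ℕ.≤ n → F j * F (2 ℕ.* n ∸ j) ≡ F n * F n + sign n * Strip.φ (n ∸ j)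
A₂-element {n} {j} j≤n =
  subst (λ m → F j * F (2 ℕ.* m ∸ j) ≡ F m * F m + sign m * Strip.φ r) (ℕₚ.m+[n∸m]≡n j≤n) element
  where
  r : ℕ
  r = n ∸ j
  reindex : 2 ℕ.* (j ℕ.+ r) ∸ j ≡ j ℕ.+ (r ℕ.+ r)
  reindex = trans (cong (_∸ j) (double j r)) (ℕₚ.m+n∸m≡n j (j ℕ.+ (r ℕ.+ r)))
    where
    double : ∀ j r → 2 ℕ.* (j ℕ.+ r) ≡ j ℕ.+ (j ℕ.+ (r ℕ.+ r))
    double = ℕ-Solver.solve-∀
  resign : - (sign j * (F r * F r)) ≡ sign (j ℕ.+ r) * Strip.φ r
  resign = begin
    - (sign j * (F r * F r))                           ≡⟨ cong (λ x → - (x * (F r * F r))) (ℤₚ.*-identityʳ (sign j)) ⟨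
    - (sign j * 1ℤ * (F r * F r))                      ≡⟨ cong (λ x → - (sign j * x * (F r * F r))) (sign-sq r) ⟨
    - (sign j * (sign r * sign r) * (F r * F r))       ≡⟨ regroup (sign j) (sign r) (F r * F r) ⟩
    sign j * sign r * (- sign r * (F r * F r))         ≡⟨ cong (_* Strip.φ r) (sign-+ j r) ⟨
    sign (j ℕ.+ r) * Strip.φ r                         ∎
    where
    open ≡-Reasoning
    regroup : ∀ x y z → - (x * (y * y) * z) ≡ x * y * (- y * z)
    regroup = solve-∀
  element : F j * F (2 ℕ.* (j ℕ.+ r) ∸ j) ≡ F (j ℕ.+ r) * F (j ℕ.+ r) + sign (j ℕ.+ r) * Strip.φ r
  element = begin
    F j * F (2 ℕ.* (j ℕ.+ r) ∸ j)                         ≡⟨ cong (λ i → F j * F i) reindex ⟩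
    F j * F (j ℕ.+ (r ℕ.+ r))
                                              ≡⟨ split (F (j ℕ.+ r) * F (j ℕ.+ r)) (F j * F (j ℕ.+ (r ℕ.+ r))) ⟩
    F (j ℕ.+ r) * F (j ℕ.+ r) - (F (j ℕ.+ r) * F (j ℕ.+ r) - F j * F (j ℕ.+ (r ℕ.+ r)))
                                                          ≡⟨ cong (λ x → F (j ℕ.+ r) * F (j ℕ.+ r) - x) (catalan j r) ⟩
    F (j ℕ.+ r) * F (j ℕ.+ r) - sign j * (F r * F r)      ≡⟨ cong (λ x → F (j ℕ.+ r) * F (j ℕ.+ r) + x) resign ⟩
    F (j ℕ.+ r) * F (j ℕ.+ r) + sign (j ℕ.+ r) * Strip.φ r ∎
    where
    open ≡-Reasoning
    split : ∀ x y → y ≡ x - (x - y)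
    split = solve-∀

B⇒A₂ : ∀ {n y} → y ∈ B n → F n * F n + sign n * y ∈ A₂ n
B⇒A₂ {n} y∈ with ∈-map⁻ Strip.φ y∈
... | r , r∈upTo , refl =
  subst (_∈ A₂ n) element (∈-map⁺ (λ k → F k * F (2 ℕ.* n ∸ k)) (∈-upTo⁺ (s≤s (ℕₚ.m∸n≤m n r))))
  where
  element : F (n ∸ r) * F (2 ℕ.* n ∸ (n ∸ r)) ≡ F n * F n + sign n * Strip.φ r
  element = trans (A₂-element (ℕₚ.m∸n≤m n r))
                  (cong (λ i → F n * F n + sign n * Strip.φ i) (ℕₚ.m∸[m∸n]≡n (ℕₚ.≤-pred (∈-upTo⁻ r∈upTo))))

A₂⇒B : ∀ {n a} → a ∈ A₂ n → - (sign n * (F n * F n)) + sign n * a ∈ B n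
A₂⇒B {n} a∈ with ∈-map⁻ (λ k → F k * F (2 ℕ.* n ∸ k)) a∈
... | j , j∈upTo , refl = subst (_∈ B n) element (φB∈B (ℕₚ.m∸n≤m n j))
  where
  element : Strip.φ (n ∸ j) ≡ - (sign n * (F n * F n)) + sign n * (F j * F (2 ℕ.* n ∸ j))
  element = begin
    Strip.φ (n ∸ j)                                         ≡⟨ unit-square (sign n) (sign-sq n) _ ⟨
    sign n * (sign n * Strip.φ (n ∸ j))                     ≡⟨ recentre (sign n) (F n * F n) _ ⟩
    - (sign n * (F n * F n)) + sign n * (F n * F n + sign n * Strip.φ (n ∸ j))
                                                            ≡⟨ cong (λ x → - (sign n * (F n * F n)) + sign n * x)
                                                                    (A₂-element (ℕₚ.≤-pred (∈-upTo⁻ j∈upTo))) ⟨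
    - (sign n * (F n * F n)) + sign n * (F j * F (2 ℕ.* n ∸ j)) ∎
    where
    open ≡-Reasoning
    recentre : ∀ s c y → s * (s * y) ≡ - (s * c) + s * (c + s * y)
    recentre = solve-∀

sumset-affine : ∀ {N m X Y} c s → (∀ {y} → y ∈ X → c + s * y ∈ Y) →
                ∀ {x} → InSumset N m X x → InSumset N m Y (+ m * c + s * x)
sumset-affine {N} {m} c s X→Y {x} (as , as∈X , N∣x-∑as) =
  V.map f as , map⁺ (VAll.map X→Y as∈X) , ∣⇒∣ᵤ (subst (N ∣_) shifted (∣n⇒∣m*n s (∣ᵤ⇒∣ N∣x-∑as)))
  where
  f : ℤ → ℤ
  f y = c + s * y
  ∑-map : ∀ {m} (as : Vec ℤ m) → sumℤ (V.map f as) ≡ + m * c + s * sumℤ as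
  ∑-map []       = empty c s
    where
    empty : ∀ c s → 0ℤ ≡ 0ℤ * c + s * 0ℤ
    empty = solve-∀
  ∑-map {suc m} (y ∷ as) = trans (cong (λ t → f y + t) (∑-map as)) (regroup c s y (sumℤ as) (+ m))
    where
    regroup : ∀ c s y t k → c + s * y + (k * c + s * t) ≡ (1ℤ + k) * c + s * (y + t)
    regroup = solve-∀
  shifted : s * (x - sumℤ as) ≡ + m * c + s * x - sumℤ (V.map f as)
  shifted = trans (regroup (+ m) c s x (sumℤ as)) (cong (λ t → + m * c + s * x - t) (sym (∑-map as)))
    where
    regroup : ∀ k c s x t → s * (x - t) ≡ k * c + s * x - (k * c + s * t)
    regroup = solve-∀

sumsetFull-affine : ∀ {N m X Y} c s → s * s ≡ 1ℤ → (∀ {y} → y ∈ X → c + s * y ∈ Y) →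
                    SumsetFull N m X → SumsetFull N m Y
sumsetFull-affine {N} {m} {X} {Y} c s s²≡1 X→Y full x =
  subst (InSumset N m Y) recovered (sumset-affine {N} c s X→Y (full (s * (x - + m * c))))
  where
  recovered : + m * c + s * (s * (x - + m * c)) ≡ x
  recovered = trans (cong (λ t → + m * c + t) (unit-square s s²≡1 (x - + m * c))) (cancel (+ m * c) x)
    where
    cancel : ∀ y x → y + (x - y) ≡ x
    cancel = solve-∀

sumsetProper-affine : ∀ {N m X Y} c s → s * s ≡ 1ℤ → (∀ {y} → y ∈ Y → - (s * c) + s * y ∈ X) →
                      SumsetProper N m X → SumsetProper N m Y
sumsetProper-affine {N} {m} {X} {Y} c s s²≡1 Y→X (x , x∉mX) =
  + m * c + s * x ,
  λ inmY → x∉mX (subst (InSumset N m X) recovered (sumset-affine {N} (- (s * c)) s Y→X inmY))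
  where
  recovered : + m * - (s * c) + s * (+ m * c + s * x) ≡ x
  recovered = trans (cancel (+ m) c s x) (unit-square s s²≡1 x)
    where
    cancel : ∀ k c s x → k * - (s * c) + s * (k * c + s * x) ≡ s * (s * x)
    cancel = solve-∀

A₂-full : ∀ k → SumsetFull (modulus (suc k)) k (A₂ (suc k))
A₂-full k = sumsetFull-affine {modulus n} (F n * F n) (sign n) (sign-sq n) B⇒A₂ (B-full k)
  where
  n : ℕ
  n = suc k

A₂-proper : ∀ w → SumsetProper (modulus (suc (suc w))) w (A₂ (suc (suc w)))
A₂-proper w = sumsetProper-affine {modulus n} (F n * F n) (sign n) (sign-sq n) A₂⇒B (Strip.B-proper w)
  where
  n : ℕ
  n = suc (suc w)

theorem1p2 : (n : ℕ) → n ≥ 1 →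
    (SumsetFull (modulus n) (n ∸ 1) (A₁ n)
      × SumsetFull (modulus n) (n ∸ 1) (A₂ n)
      × SumsetFull (modulus n) (n ∸ 1) (B n))
    × (n ≥ 2 →
      SumsetProper (modulus n) (n ∸ 2) (A₁ n)
      × SumsetProper (modulus n) (n ∸ 2) (A₂ n)
      × SumsetProper (modulus n) (n ∸ 2) (B n))
theorem1p2 zero          ()
theorem1p2 (suc zero)    _ = (A₁-full 0 , A₂-full 0 , B-full 0) , λ { (s≤s ()) }
theorem1p2 (suc (suc w)) _ = (A₁-full (suc w) , A₂-full (suc w) , B-full (suc w)) ,
                             λ _ → Fan.A₁-proper w , A₂-proper w , Strip.B-proper w
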